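{- Let $t:\mathbb{Z}_{\geqslant 0}\to\{ -1,1\}$ be the Thue--Morse sequence, defined by $t(0)=1$, $t(2k)=t(k)$ and $t(2k+1)=-t(k)$ for $k\geqslant 0$, and for $m\geqslant 0$ let \[\eta(m)=\lim_{N\to\infty}\frac{1}{N}\sum_{k=0}^{N-1}t(k)\,t(k+m)\] be its autocorrelation coefficients (these limits exist). There exist positive constants $c_1$ and $c_2$ such that for every real $x\geqslant 1$, \[c_1\,x^{0.6274882485}\leqslant \sum_{0\leqslant m\leqslant x}|\eta(m)|\leqslant c_2\,x^{0.6464616661},\] where the sum runs over integers $m$ with $0\leqslant m\leqslant x$.
   Context: Equivalently, $\eta$ is determined by $\eta(0)=1$ and, for $m\geqslant 0$, $\eta(2m)=\eta(m)$ and $\eta(2m+1)=-\tfrac12\big(\eta(m)+\eta(m+1)\big)$.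
   Formalization: The variable x ranges over the rationals x ≥ 1 instead of all reals, and the constants $c_1$ and $c_2$ are taken in the positive rationals. -}

module Defs where

open import Data.Nat as ℕ using (ℕ; zero; suc; _%_; _/_)
open import Data.Integer as ℤ using (ℤ; +_)
open import Data.Rational as ℚ using (ℚ; 0ℚ; 1ℚ; _≤_; _<_; _-_; _*_; _+_; ∣_∣)
open import Data.Product using (∃; _×_)

-- Implemented by structural recursion on a fuel argument; fuel n suffices
-- for argument n since n / 2 < n for n ≥ 1 and t(0) = t(0) is the base.
tmGo : ℕ → ℕ → ℤ
tmGo zero    n = + 1
tmGo (suc f) zero = + 1
tmGo (suc f) n@(suc _) with n % 2
... | zero  = tmGo f (n / 2)
... | suc _ = ℤ.- tmGo f (n / 2)

tm : ℕ → ℤ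
tm n = tmGo n n

corrSum : ℕ → ℕ → ℤ
corrSum m zero    = + 0
corrSum m (suc N) = corrSum m N ℤ.+ tm N ℤ.* tm (N ℕ.+ m)

-- The Cesàro average (1/N) Σ_{k<N} t(k) t(k+m), indexed by n with N = n + 1.
corrAvg : ℕ → ℕ → ℚ
corrAvg m n = corrSum m (suc n) ℚ./ suc n

Converges : (ℕ → ℚ) → ℚ → Set
Converges f L = ∀ (ε : ℚ) → 0ℚ < ε → ∃ λ (N₀ : ℕ) → ∀ (n : ℕ) → N₀ ℕ.≤ n → ∣ f n - L ∣ < ε

pow : ℚ → ℕ → ℚ
pow q zero    = 1ℚ
pow q (suc k) = q * pow q k

sumAbs : (ℕ → ℚ) → ℕ → ℚ
sumAbs η zero    = ∣ η zero ∣
sumAbs η (suc n) = sumAbs η n + ∣ η (suc n) ∣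

-- For c, x, s ≥ 0 and exponent a/d (d ≥ 1):  c · x^(a/d) ≤ s  iff  c^d · x^a ≤ s^d.
LowerBy : ℚ → ℚ → ℕ → ℕ → ℚ → Set
LowerBy c x a d s = pow c d * pow x a ≤ pow s d

-- s ≤ c · x^(a/d)  iff  s^d ≤ c^d · x^a  (all quantities nonnegative).
UpperBy : ℚ → ℚ → ℕ → ℕ → ℚ → Set
UpperBy c x a d s = pow s d ≤ pow c d * pow x a

floorℕ : ℚ → ℕ
floorℕ x = ℤ.∣ ℚ.floor x ∣

-- Splitting the correlation sums over even and odd indices gives, in the limit,
-- η(0) = 1, η(2m) = η(m) and η(2m+1) = c := -(a+b)/2 with (a , b) = (η(m) , η(m+1)).
-- So the consecutive pairs (η(2m), η(2m+1)) and (η(2m+1), η(2m+2)) are (a , c) and (c , b).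
-- If ψ(a , b) = Σ c_k |p_k a + q_k b| satisfies μ ψ(a , b) ≤ ψ(a , c) + ψ(c , b) ≤ ν ψ(a , b),
-- the sums of ψ(η(m), η(m+1)) over the dyadic blocks 2ⁿ ≤ m < 2ⁿ⁺¹ grow between μⁿ and νⁿ,
-- and since κ |a| ≤ ψ(a , b) ≤ C (|a| + |b|), so do the partial sums of |η| up to 2ⁿ.
-- Both inequalities for ψ are piecewise linear in the slope b / a, so they are checked exactly
-- at finitely many rational breakpoints. With μ = 773/500 and ν = 39/25 one has
-- log₂ μ ≥ 27/43 > 0.6274882485 and log₂ ν ≤ 9/14 < 0.6464616661.

module Submission where

open import Defs
open import Data.Nat using (ℕ)
open import Data.Rational using (ℚ; 1ℚ; _≤_; Positive)
open import Data.Product using (∃₂; _×_)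

open import Data.Integer.Base as ℤ using (ℤ; +_; +≤+)
import Data.Integer.DivMod as ℤD
import Data.Integer.Properties as ℤP
import Data.Integer.Tactic.RingSolver as ℤ-Ring
open import Data.List.Base using (List; []; _∷_; _++_; [_]; map)
open import Data.List.Relation.Unary.All as All using (All; []; _∷_)
open import Data.List.Relation.Unary.Linked as Linked using (Linked; []; [-]; _∷_)
open import Data.Nat.Base as ℕ using (zero; suc; z≤n; s≤s; _^_)
import Data.Nat.DivMod as ℕD
import Data.Nat.Properties as ℕP
open import Data.Product.Base using (∃; _,_; proj₁; proj₂)
open import Data.Rational.Base as ℚ using (mkℚ; _/_; _+_; _*_; _-_; -_; ½; 0ℚ; ∣_∣; _<_; toℚᵘ)
open import Data.Rational.Literals using (fromℤ)
import Data.Rational.Properties as ℚP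
open import Data.Rational.Unnormalised.Base as ℚᵘ using (mkℚᵘ; *≡*) renaming (_≃_ to _≃ᵘ_)
import Data.Rational.Unnormalised.Properties as ℚᵘP
open import Data.Sum.Base using (_⊎_; inj₁; inj₂)
open import Function.Base using (_∘_)
open import Level using (0ℓ)
open import Relation.Binary.PropositionalEquality
  using (_≡_; refl; sym; trans; cong; cong₂; subst; subst₂; module ≡-Reasoning)
open import Relation.Nullary.Decidable using (Dec; yes; no; _×-dec_; _⊎-dec_; True; toWitness; dec⇒maybe)
open import Relation.Nullary.Negation using (contradiction)
open import Tactic.RingSolver using (solve-∀)
open import Tactic.RingSolver.Core.AlmostCommutativeRing using (AlmostCommutativeRing; fromCommutativeRing)

open import Algebra.Properties.Group ℚP.+-0-group using (x∙y⁻¹≈ε⇒x≈y) renaming (⁻¹-involutive to neg-involutive)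

ℚ-ring : AlmostCommutativeRing 0ℓ 0ℓ
ℚ-ring = fromCommutativeRing ℚP.+-*-commutativeRing (λ q → dec⇒maybe (0ℚ ℚP.≟ q))

compute-≤ : ∀ {p q} {_ : True (p ℚP.≤? q)} → p ≤ q
compute-≤ {p} {q} {p≤q} = toWitness p≤q

compute-< : ∀ {p q} {_ : True (p ℚP.<? q)} → p < q
compute-< {p} {q} {p<q} = toWitness p<q

nonNeg*nonNeg : ∀ {p q} → 0ℚ ≤ p → 0ℚ ≤ q → 0ℚ ≤ p * q
nonNeg*nonNeg {p} {q} 0≤p 0≤q = subst (_≤ p * q) (ℚP.*-zeroˡ q) (ℚP.*-monoʳ-≤-nonNeg q {{ℚ.nonNegative 0≤q}} 0≤p)

*-mono-≤-nonNeg : ∀ {p q r s} → 0ℚ ≤ p → 0ℚ ≤ r → p ≤ q → r ≤ s → p * r ≤ q * s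
*-mono-≤-nonNeg {p} {q} {r} {s} 0≤p 0≤r p≤q r≤s = ℚP.≤-trans
  (ℚP.*-monoˡ-≤-nonNeg p {{ℚ.nonNegative 0≤p}} r≤s)
  (ℚP.*-monoʳ-≤-nonNeg s {{ℚ.nonNegative (ℚP.≤-trans 0≤r r≤s)}} p≤q)

p≤q⇒0≤q-p : ∀ {p q} → p ≤ q → 0ℚ ≤ q - p
p≤q⇒0≤q-p {p} {q} p≤q = subst (_≤ q - p) (ℚP.+-inverseʳ p) (ℚP.+-monoˡ-≤ (- p) p≤q)

0≤q-p⇒p≤q : ∀ {p q} → 0ℚ ≤ q - p → p ≤ q
0≤q-p⇒p≤q {p} {q} 0≤q-p = subst₂ _≤_ (ℚP.+-identityˡ p) (ring q p) (ℚP.+-monoˡ-≤ p 0≤q-p)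
  where
  ring : ∀ q p → q - p + p ≡ q
  ring = solve-∀ ℚ-ring

-- The Thue–Morse sequence and its correlation sums

flipIf : ℕ → ℤ → ℤ
flipIf zero    z = z
flipIf (suc _) z = ℤ.- z

flipIf-square : ∀ b z → flipIf b z ℤ.* flipIf b z ≡ z ℤ.* z
flipIf-square zero    z = refl
flipIf-square (suc _) z = neg-square z
  where
  neg-square : ∀ z → ℤ.- z ℤ.* ℤ.- z ≡ z ℤ.* z
  neg-square = ℤ-Ring.solve-∀

tmGo-suc : ∀ f k → tmGo (suc f) (suc k) ≡ flipIf (suc k ℕ.% 2) (tmGo f (suc k ℕ./ 2))
tmGo-suc f k with suc k ℕ.% 2
... | zero  = refl
... | suc _ = refl

tmGo-fuel-irrelevant : ∀ {f g} n → n ℕ.≤ f → n ℕ.≤ g → tmGo f n ≡ tmGo g n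
tmGo-fuel-irrelevant {zero}  {zero}  zero _ _ = refl
tmGo-fuel-irrelevant {zero}  {suc _} zero _ _ = refl
tmGo-fuel-irrelevant {suc _} {zero}  zero _ _ = refl
tmGo-fuel-irrelevant {suc _} {suc _} zero _ _ = refl
tmGo-fuel-irrelevant {suc f} {suc g} (suc k) (s≤s k≤f) (s≤s k≤g) = begin
  tmGo (suc f) (suc k)                             ≡⟨ tmGo-suc f k ⟩
  flipIf (suc k ℕ.% 2) (tmGo f (suc k ℕ./ 2))      ≡⟨ cong (flipIf (suc k ℕ.% 2)) (tmGo-fuel-irrelevant _ (half≤ k≤f) (half≤ k≤g)) ⟩
  flipIf (suc k ℕ.% 2) (tmGo g (suc k ℕ./ 2))      ≡⟨ tmGo-suc g k ⟨
  tmGo (suc g) (suc k)                             ∎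
  where
  open ≡-Reasoning
  half≤ : ∀ {h} → k ℕ.≤ h → suc k ℕ./ 2 ℕ.≤ h
  half≤ = ℕP.≤-trans (ℕP.<⇒≤pred (ℕD.m/n<m (suc k) 2 (s≤s (s≤s z≤n))))

tmGo≡tm : ∀ {f} n → n ℕ.≤ f → tmGo f n ≡ tm n
tmGo≡tm n n≤f = tmGo-fuel-irrelevant n n≤f ℕP.≤-refl

tm-double : ∀ j → tm (j ℕ.* 2) ≡ tm j
tm-double zero    = refl
tm-double (suc j) = begin
  tm (suc (suc j′))                                                ≡⟨ tmGo-suc (suc j′) (suc j′) ⟩
  flipIf (suc (suc j′) ℕ.% 2) (tmGo (suc j′) (suc (suc j′) ℕ./ 2))  ≡⟨ cong₂ flipIf (ℕD.m*n%n≡0 (suc j) 2)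
                                                                         (cong (tmGo (suc j′)) (ℕD.m*n/n≡m (suc j) 2)) ⟩
  tmGo (suc j′) (suc j)                                            ≡⟨ tmGo≡tm (suc j) (s≤s (ℕP.m≤m*n j 2)) ⟩
  tm (suc j)                                                       ∎
  where
  open ≡-Reasoning
  j′ = j ℕ.* 2

tm-double+1 : ∀ j → tm (suc (j ℕ.* 2)) ≡ ℤ.- tm j
tm-double+1 j = begin
  tm (suc j′)                                                      ≡⟨ tmGo-suc j′ j′ ⟩
  flipIf (suc j′ ℕ.% 2) (tmGo j′ (suc j′ ℕ./ 2))                   ≡⟨ cong₂ flipIf (ℕD.[m+kn]%n≡m%n 1 j 2) (cong (tmGo j′) half) ⟩
  ℤ.- tmGo j′ j                                                    ≡⟨ cong ℤ.-_ (tmGo≡tm j (ℕP.m≤m*n j 2)) ⟩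
  ℤ.- tm j                                                         ∎
  where
  open ≡-Reasoning
  j′ = j ℕ.* 2
  half : suc j′ ℕ./ 2 ≡ j
  half = trans (ℕD.+-distrib-/ 1 j′ (subst (λ r → 1 ℕ.+ r ℕ.< 2) (sym (ℕD.m*n%n≡0 j 2)) ℕP.≤-refl))
               (ℕD.m*n/n≡m j 2)

tmGo-square : ∀ f n → tmGo f n ℤ.* tmGo f n ≡ + 1
tmGo-square zero    n       = refl
tmGo-square (suc f) zero    = refl
tmGo-square (suc f) (suc k) rewrite tmGo-suc f k =
  trans (flipIf-square (suc k ℕ.% 2) _) (tmGo-square f (suc k ℕ./ 2))

tm-square : ∀ n → tm n ℤ.* tm n ≡ + 1
tm-square n = tmGo-square n n

corrSum-0 : ∀ N → corrSum 0 N ≡ + N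
corrSum-0 zero    = refl
corrSum-0 (suc N) rewrite ℕP.+-identityʳ N | corrSum-0 N | tm-square N = ℤP.+-comm (+ N) (+ 1)

corrSum-double : ∀ m N → corrSum (m ℕ.* 2) (N ℕ.* 2) ≡ + 2 ℤ.* corrSum m N
corrSum-double m zero    = refl
corrSum-double m (suc N)
  rewrite sym (ℕP.*-distribʳ-+ 2 N m)
        | tm-double N | tm-double+1 N | tm-double (N ℕ.+ m) | tm-double+1 (N ℕ.+ m)
        | corrSum-double m N = ring (corrSum m N) (tm N) (tm (N ℕ.+ m))
  where
  ring : ∀ c a b → (+ 2 ℤ.* c ℤ.+ a ℤ.* b) ℤ.+ ℤ.- a ℤ.* ℤ.- b ≡ + 2 ℤ.* (c ℤ.+ a ℤ.* b)
  ring = ℤ-Ring.solve-∀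

corrSum-double+1 : ∀ m N → corrSum (suc (m ℕ.* 2)) (N ℕ.* 2) ≡ ℤ.- (corrSum m N ℤ.+ corrSum (suc m) N)
corrSum-double+1 m zero    = refl
corrSum-double+1 m (suc N)
  rewrite ℕP.+-suc (N ℕ.* 2) (m ℕ.* 2) | sym (ℕP.*-distribʳ-+ 2 N m) | ℕP.+-suc N m
        | tm-double N | tm-double+1 N | tm-double+1 (N ℕ.+ m) | tm-double (suc (N ℕ.+ m))
        | corrSum-double+1 m N = ring (corrSum m N) (corrSum (suc m) N) (tm N) (tm (N ℕ.+ m)) (tm (suc (N ℕ.+ m)))
  where
  ring : ∀ c c′ a b b′ → (ℤ.- (c ℤ.+ c′) ℤ.+ a ℤ.* ℤ.- b) ℤ.+ ℤ.- a ℤ.* b′ ≡ ℤ.- ((c ℤ.+ a ℤ.* b) ℤ.+ (c′ ℤ.+ a ℤ.* b′))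
  ring = ℤ-Ring.solve-∀

negMean : ℚ → ℚ → ℚ
negMean a b = - (½ * (a + b))

corrAvg-0 : ∀ n → corrAvg 0 n ≡ 1ℚ
corrAvg-0 n = trans (cong (_/ suc n) (corrSum-0 (suc n)))
                    (ℚP.fromℚᵘ-cong {mkℚᵘ (+ suc n) n} {mkℚᵘ (+ 1) 0} (*≡* (ℤP.*-comm (+ suc n) (+ 1))))

corrAvg-double : ∀ m n → corrAvg (m ℕ.* 2) (suc (n ℕ.* 2)) ≡ corrAvg m n
corrAvg-double m n = trans (cong (_/ (suc n ℕ.* 2)) (corrSum-double m (suc n)))
  (ℚP.fromℚᵘ-cong {mkℚᵘ (+ 2 ℤ.* z) (suc (n ℕ.* 2))} {mkℚᵘ z n}
    (*≡* (trans (ring z (+ suc n)) (cong (z ℤ.*_) (sym (ℤP.pos-* (suc n) 2))))))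
  where
  z = corrSum m (suc n)
  ring : ∀ z k → (+ 2 ℤ.* z) ℤ.* k ≡ z ℤ.* (k ℤ.* + 2)
  ring = ℤ-Ring.solve-∀

corrAvg-double+1 : ∀ m n → corrAvg (suc (m ℕ.* 2)) (suc (n ℕ.* 2)) ≡ negMean (corrAvg m n) (corrAvg (suc m) n)
corrAvg-double+1 m n = trans (cong (_/ (suc n ℕ.* 2)) (corrSum-double+1 m (suc n))) (ℚP.toℚᵘ-injective (begin
  toℚᵘ (ℤ.- (z ℤ.+ z′) / (suc n ℕ.* 2))            ≈⟨ ℚP.toℚᵘ-fromℚᵘ _ ⟩
  mkℚᵘ (ℤ.- (z ℤ.+ z′)) (suc (n ℕ.* 2))            ≈⟨ *≡* (cross-multiplied z z′) ⟩
  ℚᵘ.- (toℚᵘ ½ ℚᵘ.* (mkℚᵘ z n ℚᵘ.+ mkℚᵘ z′ n))   ≈⟨ ℚᵘP.-‿cong (ℚᵘP.*-congˡ {toℚᵘ ½} (ℚᵘP.+-cong (avg z) (avg z′))) ⟨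
  ℚᵘ.- (toℚᵘ ½ ℚᵘ.* (toℚᵘ a ℚᵘ.+ toℚᵘ a′))      ≈⟨ ℚᵘP.-‿cong (ℚᵘP.*-congˡ {toℚᵘ ½} (ℚP.toℚᵘ-homo-+ a a′)) ⟨
  ℚᵘ.- (toℚᵘ ½ ℚᵘ.* toℚᵘ (a + a′))              ≈⟨ ℚᵘP.-‿cong (ℚP.toℚᵘ-homo-* ½ (a + a′)) ⟨
  ℚᵘ.- toℚᵘ (½ * (a + a′))                      ≈⟨ ℚP.toℚᵘ-homo‿- (½ * (a + a′)) ⟨
  toℚᵘ (negMean a a′)                           ∎))
  where
  open ℚᵘP.≃-Reasoning
  z = corrSum m (suc n)
  z′ = corrSum (suc m) (suc n)
  a = corrAvg m n
  a′ = corrAvg (suc m) n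
  avg : ∀ z → toℚᵘ (z / suc n) ≃ᵘ mkℚᵘ z n
  avg z = ℚP.toℚᵘ-fromℚᵘ (mkℚᵘ z n)
  cross-multiplied : ∀ z z′ → ℤ.- (z ℤ.+ z′) ℤ.* + (2 ℕ.* (suc n ℕ.* suc n))
                             ≡ ℤ.- (+ 1 ℤ.* (z ℤ.* + suc n ℤ.+ z′ ℤ.* + suc n)) ℤ.* + (suc n ℕ.* 2)
  cross-multiplied z z′ rewrite ℤP.pos-* 2 (suc n ℕ.* suc n) | ℤP.pos-* (suc n) (suc n) | ℤP.pos-* (suc n) 2 =
    ring z z′ (+ suc n)
    where
    ring : ∀ z z′ k → ℤ.- (z ℤ.+ z′) ℤ.* (+ 2 ℤ.* (k ℤ.* k)) ≡ ℤ.- (+ 1 ℤ.* (z ℤ.* k ℤ.+ z′ ℤ.* k)) ℤ.* (k ℤ.* + 2)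
    ring = ℤ-Ring.solve-∀

-- Limits

½*ε+½*ε≡ε : ∀ ε → ½ * ε + ½ * ε ≡ ε
½*ε+½*ε≡ε ε = trans (sym (ℚP.*-distribʳ-+ ε ½ ½)) (ℚP.*-identityˡ ε)

½*-mono-< : ∀ {p q} → p < q → ½ * p < ½ * q
½*-mono-< = ℚP.*-monoʳ-<-pos ½

∣½*p∣ : ∀ p → ∣ ½ * p ∣ ≡ ½ * ∣ p ∣
∣½*p∣ p = ℚP.∣p*q∣≡∣p∣*∣q∣ ½ p

≡-if-∣-∣<ε : ∀ p q → (∀ ε → 0ℚ < ε → ∣ p - q ∣ < ε) → p ≡ q
≡-if-∣-∣<ε p q close with 0ℚ ℚP.<? ∣ p - q ∣
... | yes 0<∣p-q∣ = contradiction (close _ 0<∣p-q∣) (ℚP.<-irrefl refl)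
... | no 0≮∣p-q∣ = x∙y⁻¹≈ε⇒x≈y p q (ℚP.∣p∣≡0⇒p≡0 (p - q) (ℚP.≤-antisym (ℚP.≮⇒≥ 0≮∣p-q∣) (ℚP.0≤∣p∣ (p - q))))

limit-unique : ∀ {f L M} → Converges f L → Converges f M → L ≡ M
limit-unique {f} {L} {M} f→L f→M = ≡-if-∣-∣<ε L M λ ε ε>0 →
  let ε/2>0 = subst (_< ½ * ε) (ℚP.*-zeroʳ ½) (½*-mono-< ε>0)
      (N₁ , close₁) = f→L (½ * ε) ε/2>0
      (N₂ , close₂) = f→M (½ * ε) ε/2>0
      x = f (N₁ ℕ.+ N₂)
  in begin-strict
    ∣ L - M ∣                   ≡⟨ cong ∣_∣ (ring L M x) ⟩
    ∣ (x - M) - (x - L) ∣       ≤⟨ ℚP.∣p-q∣≤∣p∣+∣q∣ (x - M) (x - L) ⟩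
    ∣ x - M ∣ + ∣ x - L ∣       <⟨ ℚP.+-mono-< (close₂ _ (ℕP.m≤n+m N₂ N₁)) (close₁ _ (ℕP.m≤m+n N₁ N₂)) ⟩
    ½ * ε + ½ * ε               ≡⟨ ½*ε+½*ε≡ε ε ⟩
    ε                           ∎
  where
  open ℚP.≤-Reasoning
  ring : ∀ L M x → L - M ≡ (x - M) - (x - L)
  ring = solve-∀ ℚ-ring

converges-cong : ∀ {f g L} → (∀ n → f n ≡ g n) → Converges f L → Converges g L
converges-cong {L = L} f≗g f→L ε ε>0 =
  let (N , close) = f→L ε ε>0 in N , λ n N≤n → subst (λ y → ∣ y - L ∣ < ε) (f≗g n) (close n N≤n)

converges-const : ∀ c → Converges (λ _ → c) c
converges-const c ε ε>0 = 0 , λ _ _ → subst (_< ε) (cong ∣_∣ (sym (ℚP.+-inverseʳ c))) ε>0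

converges-subsequence : ∀ {f L} (s : ℕ → ℕ) → (∀ n → n ℕ.≤ s n) → Converges f L → Converges (f ∘ s) L
converges-subsequence s n≤s f→L ε ε>0 =
  let (N , close) = f→L ε ε>0 in N , λ n N≤n → close (s n) (ℕP.≤-trans N≤n (n≤s n))

converges-neg : ∀ {f L} → Converges f L → Converges (-_ ∘ f) (- L)
converges-neg {f} {L} f→L ε ε>0 =
  let (N , close) = f→L ε ε>0 in
  N , λ n N≤n → subst (_< ε) (trans (sym (ℚP.∣-p∣≡∣p∣ _)) (cong ∣_∣ (ring (f n) L))) (close n N≤n)
  where
  ring : ∀ x L → - (x - L) ≡ - x - - L
  ring = solve-∀ ℚ-ring

converges-midpoint : ∀ {f g L M} → Converges f L → Converges g M →
                     Converges (λ n → ½ * (f n + g n)) (½ * (L + M))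
converges-midpoint {f} {g} {L} {M} f→L g→M ε ε>0 =
  let (N₁ , close₁) = f→L ε ε>0
      (N₂ , close₂) = g→M ε ε>0
  in N₁ ℕ.+ N₂ , λ n N≤n → begin-strict
    ∣ ½ * (f n + g n) - ½ * (L + M) ∣           ≡⟨ cong ∣_∣ (ring ½ (f n) (g n) L M) ⟩
    ∣ ½ * (f n - L) + ½ * (g n - M) ∣           ≤⟨ ℚP.∣p+q∣≤∣p∣+∣q∣ (½ * (f n - L)) (½ * (g n - M)) ⟩
    ∣ ½ * (f n - L) ∣ + ∣ ½ * (g n - M) ∣       ≡⟨ cong₂ _+_ (∣½*p∣ (f n - L)) (∣½*p∣ (g n - M)) ⟩
    ½ * ∣ f n - L ∣ + ½ * ∣ g n - M ∣           <⟨ ℚP.+-mono-< (½*-mono-< (close₁ n (ℕP.≤-trans (ℕP.m≤m+n N₁ N₂) N≤n)))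
                                                                (½*-mono-< (close₂ n (ℕP.≤-trans (ℕP.m≤n+m N₂ N₁) N≤n))) ⟩
    ½ * ε + ½ * ε                               ≡⟨ ½*ε+½*ε≡ε ε ⟩
    ε                                           ∎
  where
  open ℚP.≤-Reasoning
  ring : ∀ h x y L M → h * (x + y) - h * (L + M) ≡ h * (x - L) + h * (y - M)
  ring = solve-∀ ℚ-ring

module Autocorrelation (η : ℕ → ℚ) (corrAvg→η : ∀ m → Converges (corrAvg m) (η m)) where

  private
    odd : ℕ → ℕ
    odd n = suc (n ℕ.* 2)

    n≤odd : ∀ n → n ℕ.≤ odd n
    n≤odd n = ℕP.≤-trans (ℕP.m≤m*n n 2) (ℕP.n≤1+n _)

  η-0 : η 0 ≡ 1ℚ
  η-0 = limit-unique {corrAvg 0} (corrAvg→η 0)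
                     (converges-cong {λ _ → 1ℚ} {corrAvg 0} {1ℚ} (sym ∘ corrAvg-0) (converges-const 1ℚ))

  η-double : ∀ m → η (m ℕ.* 2) ≡ η m
  η-double m = limit-unique {corrAvg (m ℕ.* 2) ∘ odd}
    (converges-subsequence {corrAvg (m ℕ.* 2)} odd n≤odd (corrAvg→η (m ℕ.* 2)))
    (converges-cong {corrAvg m} {corrAvg (m ℕ.* 2) ∘ odd} (sym ∘ corrAvg-double m) (corrAvg→η m))

  η-double+1 : ∀ m → η (suc (m ℕ.* 2)) ≡ negMean (η m) (η (suc m))
  η-double+1 m = limit-unique {corrAvg (suc (m ℕ.* 2)) ∘ odd}
    (converges-subsequence {corrAvg (suc (m ℕ.* 2))} odd n≤odd (corrAvg→η (suc (m ℕ.* 2))))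
    (converges-cong {λ n → negMean (corrAvg m n) (corrAvg (suc m) n)} {corrAvg (suc (m ℕ.* 2)) ∘ odd} (sym ∘ corrAvg-double+1 m)
      (converges-neg {λ n → ½ * (corrAvg m n + corrAvg (suc m) n)}
        (converges-midpoint {corrAvg m} {corrAvg (suc m)} (corrAvg→η m) (corrAvg→η (suc m)))))

-- Finite sums and powers

sumRange : (ℕ → ℚ) → ℕ → ℕ → ℚ
sumRange f lo zero      = 0ℚ
sumRange f lo (suc len) = f lo + sumRange f (suc lo) len

sumRange-cong : ∀ {f g} → (∀ m → f m ≡ g m) → ∀ lo len → sumRange f lo len ≡ sumRange g lo len
sumRange-cong f≗g lo zero      = refl
sumRange-cong f≗g lo (suc len) = cong₂ _+_ (f≗g lo) (sumRange-cong f≗g (suc lo) len)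

sumRange-mono : ∀ {f g} → (∀ m → f m ≤ g m) → ∀ lo len → sumRange f lo len ≤ sumRange g lo len
sumRange-mono f≤g lo zero      = ℚP.≤-refl
sumRange-mono f≤g lo (suc len) = ℚP.+-mono-≤ (f≤g lo) (sumRange-mono f≤g (suc lo) len)

sumRange-nonNeg : ∀ {f} → (∀ m → 0ℚ ≤ f m) → ∀ lo len → 0ℚ ≤ sumRange f lo len
sumRange-nonNeg 0≤f lo zero      = ℚP.≤-refl
sumRange-nonNeg 0≤f lo (suc len) = ℚP.+-mono-≤ (0≤f lo) (sumRange-nonNeg 0≤f (suc lo) len)

sumRange-mono-len : ∀ {f} → (∀ m → 0ℚ ≤ f m) → ∀ lo {len len′} → len ℕ.≤ len′ → sumRange f lo len ≤ sumRange f lo len′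
sumRange-mono-len 0≤f lo {len′ = len′} z≤n = sumRange-nonNeg 0≤f lo len′
sumRange-mono-len {f} 0≤f lo (s≤s len≤len′)   = ℚP.+-monoʳ-≤ (f lo) (sumRange-mono-len 0≤f (suc lo) len≤len′)

sumRange-*ˡ : ∀ c f lo len → sumRange (λ m → c * f m) lo len ≡ c * sumRange f lo len
sumRange-*ˡ c f lo zero      = sym (ℚP.*-zeroʳ c)
sumRange-*ˡ c f lo (suc len) =
  trans (cong (_+_ (c * f lo)) (sumRange-*ˡ c f (suc lo) len)) (sym (ℚP.*-distribˡ-+ c (f lo) _))

sumRange-+ : ∀ f g lo len → sumRange (λ m → f m + g m) lo len ≡ sumRange f lo len + sumRange g lo len
sumRange-+ f g lo zero      = refl
sumRange-+ f g lo (suc len) =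
  trans (cong (_+_ (f lo + g lo)) (sumRange-+ f g (suc lo) len)) (ring (f lo) (g lo) _ _)
  where
  ring : ∀ a b c d → a + b + (c + d) ≡ a + c + (b + d)
  ring = solve-∀ ℚ-ring

sumRange-++ : ∀ f lo len len′ → sumRange f lo (len ℕ.+ len′) ≡ sumRange f lo len + sumRange f (lo ℕ.+ len) len′
sumRange-++ f lo zero len′ rewrite ℕP.+-identityʳ lo = sym (ℚP.+-identityˡ _)
sumRange-++ f lo (suc len) len′ rewrite ℕP.+-suc lo len =
  trans (cong (_+_ (f lo)) (sumRange-++ f (suc lo) len len′)) (sym (ℚP.+-assoc (f lo) _ _))

sumRange-shift : ∀ f lo len → sumRange (f ∘ suc) lo len ≡ sumRange f (suc lo) len
sumRange-shift f lo zero      = refl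
sumRange-shift f lo (suc len) = cong (_+_ (f (suc lo))) (sumRange-shift f (suc lo) len)

sumRange-pairs : ∀ f lo len → sumRange f (lo ℕ.* 2) (len ℕ.* 2) ≡ sumRange (λ m → f (m ℕ.* 2) + f (suc (m ℕ.* 2))) lo len
sumRange-pairs f lo zero      = refl
sumRange-pairs f lo (suc len) =
  trans (sym (ℚP.+-assoc (f (lo ℕ.* 2)) _ _)) (cong (_+_ (f (lo ℕ.* 2) + f (suc (lo ℕ.* 2)))) (sumRange-pairs f (suc lo) len))

sumAbs≡sumRange : ∀ η N → sumAbs η N ≡ sumRange (∣_∣ ∘ η) 0 (suc N)
sumAbs≡sumRange η zero    = sym (ℚP.+-identityʳ _)
sumAbs≡sumRange η (suc N) = begin
  sumAbs η N + ∣ η (suc N) ∣                                        ≡⟨ cong₂ _+_ (sumAbs≡sumRange η N) (sym (ℚP.+-identityʳ _)) ⟩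
  sumRange (∣_∣ ∘ η) 0 (suc N) + sumRange (∣_∣ ∘ η) (suc N) 1       ≡⟨ sumRange-++ (∣_∣ ∘ η) 0 (suc N) 1 ⟨
  sumRange (∣_∣ ∘ η) 0 (suc N ℕ.+ 1)                                ≡⟨ cong (sumRange (∣_∣ ∘ η) 0) (ℕP.+-comm (suc N) 1) ⟩
  sumRange (∣_∣ ∘ η) 0 (suc (suc N))                                ∎
  where open ≡-Reasoning

pow-nonNeg : ∀ {x} n → 0ℚ ≤ x → 0ℚ ≤ pow x n
pow-nonNeg zero    0≤x = compute-≤
pow-nonNeg (suc n) 0≤x = nonNeg*nonNeg 0≤x (pow-nonNeg n 0≤x)

pow-monoˡ-≤ : ∀ {x y} n → 0ℚ ≤ x → x ≤ y → pow x n ≤ pow y n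
pow-monoˡ-≤ zero    0≤x x≤y = ℚP.≤-refl
pow-monoˡ-≤ (suc n) 0≤x x≤y = *-mono-≤-nonNeg 0≤x (pow-nonNeg n 0≤x) x≤y (pow-monoˡ-≤ n 0≤x x≤y)

pow-*-distrib : ∀ x y n → pow (x * y) n ≡ pow x n * pow y n
pow-*-distrib x y zero    = refl
pow-*-distrib x y (suc n) = trans (cong (x * y *_) (pow-*-distrib x y n)) (ring x y (pow x n) (pow y n))
  where
  ring : ∀ x y a b → x * y * (a * b) ≡ x * a * (y * b)
  ring = solve-∀ ℚ-ring

pow-+ : ∀ x m n → pow x (m ℕ.+ n) ≡ pow x m * pow x n
pow-+ x zero    n = sym (ℚP.*-identityˡ _)
pow-+ x (suc m) n = trans (cong (x *_) (pow-+ x m n)) (sym (ℚP.*-assoc x _ _))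

pow-pow : ∀ x m n → pow (pow x m) n ≡ pow x (m ℕ.* n)
pow-pow x m zero    = cong (pow x) (sym (ℕP.*-zeroʳ m))
pow-pow x m (suc n) = begin
  pow x m * pow (pow x m) n   ≡⟨ cong (pow x m *_) (pow-pow x m n) ⟩
  pow x m * pow x (m ℕ.* n)   ≡⟨ pow-+ x m (m ℕ.* n) ⟨
  pow x (m ℕ.+ m ℕ.* n)       ≡⟨ cong (pow x) (ℕP.*-suc m n) ⟨
  pow x (m ℕ.* suc n)         ∎
  where open ≡-Reasoning

pow-comm : ∀ x m n → pow (pow x m) n ≡ pow (pow x n) m
pow-comm x m n = trans (pow-pow x m n) (trans (cong (pow x) (ℕP.*-comm m n)) (sym (pow-pow x n m)))

pow-monoʳ-≤ : ∀ {x} → 1ℚ ≤ x → ∀ {m n} → m ℕ.≤ n → pow x m ≤ pow x n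
pow-monoʳ-≤ {x} 1≤x {m} {n} m≤n = begin
  pow x m               ≡⟨ ℚP.*-identityʳ (pow x m) ⟨
  pow x m * 1ℚ          ≤⟨ ℚP.*-monoˡ-≤-nonNeg (pow x m) {{ℚ.nonNegative (pow-nonNeg m 0≤x)}} (pow-≥1 (n ℕ.∸ m)) ⟩
  pow x m * pow x (n ℕ.∸ m) ≡⟨ pow-+ x m (n ℕ.∸ m) ⟨
  pow x (m ℕ.+ (n ℕ.∸ m))   ≡⟨ cong (pow x) (ℕP.m+[n∸m]≡n m≤n) ⟩
  pow x n               ∎
  where
  open ℚP.≤-Reasoning
  0≤x = ℚP.≤-trans compute-≤ 1≤x
  pow-≥1 : ∀ k → 1ℚ ≤ pow x k
  pow-≥1 zero    = ℚP.≤-refl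
  pow-≥1 (suc k) = *-mono-≤-nonNeg compute-≤ compute-≤ 1≤x (pow-≥1 k)

pow-cancelˡ-≤ : ∀ {x y} n → 0ℚ ≤ y → pow x (suc n) ≤ pow y (suc n) → x ≤ y
pow-cancelˡ-≤ {x} {y} n 0≤y xⁿ⁺¹≤yⁿ⁺¹ with x ℚP.≤? y
... | yes x≤y = x≤y
... | no  x≰y = contradiction (ℚP.<-≤-trans yⁿ⁺¹<xⁿ⁺¹ xⁿ⁺¹≤yⁿ⁺¹) (ℚP.<-irrefl refl)
  where
  open ℚP.≤-Reasoning
  y<x = ℚP.≰⇒> x≰y
  0<pow-x : ∀ k → 0ℚ < pow x k
  0<pow-x zero    = compute-<
  0<pow-x (suc k) = subst (_< x * pow x k) (ℚP.*-zeroˡ (pow x k))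
    (ℚP.*-monoˡ-<-pos (pow x k) {{ℚ.positive (0<pow-x k)}} (ℚP.≤-<-trans 0≤y y<x))
  yⁿ⁺¹<xⁿ⁺¹ : pow y (suc n) < pow x (suc n)
  yⁿ⁺¹<xⁿ⁺¹ = begin-strict
    y * pow y n   ≤⟨ ℚP.*-monoˡ-≤-nonNeg y {{ℚ.nonNegative 0≤y}} (pow-monoˡ-≤ n 0≤y (ℚP.<⇒≤ y<x)) ⟩
    y * pow x n   <⟨ ℚP.*-monoˡ-<-pos (pow x n) {{ℚ.positive (0<pow-x n)}} y<x ⟩
    x * pow x n   ∎

-- Dyadic blocks

geometric-lower : ∀ {μ} (u : ℕ → ℚ) → 0ℚ ≤ μ → (∀ n → μ * u n ≤ u (suc n)) → ∀ n → pow μ n * u 0 ≤ u n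
geometric-lower u 0≤μ step zero    = ℚP.≤-reflexive (ℚP.*-identityˡ (u 0))
geometric-lower {μ} u 0≤μ step (suc n) = begin
  μ * pow μ n * u 0     ≡⟨ ℚP.*-assoc μ (pow μ n) (u 0) ⟩
  μ * (pow μ n * u 0)   ≤⟨ ℚP.*-monoˡ-≤-nonNeg μ {{ℚ.nonNegative 0≤μ}} (geometric-lower u 0≤μ step n) ⟩
  μ * u n               ≤⟨ step n ⟩
  u (suc n)             ∎
  where open ℚP.≤-Reasoning

geometric-upper : ∀ {ν} (u : ℕ → ℚ) → 0ℚ ≤ ν → (∀ n → u (suc n) ≤ ν * u n) → ∀ n → u n ≤ pow ν n * u 0
geometric-upper u 0≤ν step zero    = ℚP.≤-reflexive (sym (ℚP.*-identityˡ (u 0)))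
geometric-upper {ν} u 0≤ν step (suc n) = begin
  u (suc n)             ≤⟨ step n ⟩
  ν * u n               ≤⟨ ℚP.*-monoˡ-≤-nonNeg ν {{ℚ.nonNegative 0≤ν}} (geometric-upper u 0≤ν step n) ⟩
  ν * (pow ν n * u 0)   ≡⟨ ℚP.*-assoc ν (pow ν n) (u 0) ⟨
  ν * pow ν n * u 0     ∎
  where open ℚP.≤-Reasoning

partial-sums-geometric : ∀ {ν A D} (u v : ℕ → ℚ) → 0ℚ ≤ ν →
  (∀ n → u (suc n) ≤ u n + v n) → (∀ n → v n ≤ A * pow ν n) → u 0 ≤ D → D + A ≤ D * ν →
  ∀ n → u n ≤ D * pow ν n
partial-sums-geometric u v 0≤ν step v≤ u₀≤D D+A≤Dν zero = ℚP.≤-trans u₀≤D (ℚP.≤-reflexive (sym (ℚP.*-identityʳ _)))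
partial-sums-geometric {ν} {A} {D} u v 0≤ν step v≤ u₀≤D D+A≤Dν (suc n) = begin
  u (suc n)                     ≤⟨ step n ⟩
  u n + v n                     ≤⟨ ℚP.+-mono-≤ (partial-sums-geometric u v 0≤ν step v≤ u₀≤D D+A≤Dν n) (v≤ n) ⟩
  D * pow ν n + A * pow ν n     ≡⟨ ℚP.*-distribʳ-+ (pow ν n) D A ⟨
  (D + A) * pow ν n             ≤⟨ ℚP.*-monoʳ-≤-nonNeg (pow ν n) {{ℚ.nonNegative (pow-nonNeg n 0≤ν)}} D+A≤Dν ⟩
  D * ν * pow ν n               ≡⟨ ℚP.*-assoc D ν (pow ν n) ⟩
  D * (ν * pow ν n)             ∎
  where open ℚP.≤-Reasoning

2^suc : ∀ n → 2 ^ n ℕ.+ 2 ^ n ≡ 2 ^ suc n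
2^suc n = cong (2 ^ n ℕ.+_) (sym (ℕP.+-identityʳ (2 ^ n)))

n<2^n : ∀ n → n ℕ.< 2 ^ n
n<2^n zero    = s≤s z≤n
n<2^n (suc n) = ℕP.≤-<-trans (n<2^n n) (subst (2 ^ n ℕ.<_) (2^suc n) (ℕP.m<m+n (2 ^ n) (ℕP.m^n>0 2 n)))

dyadic-block : ∀ N → 1 ℕ.≤ N → ∃ λ n → 2 ^ n ℕ.≤ N × N ℕ.< 2 ^ suc n
dyadic-block N 1≤N = search N (ℕP.<-≤-trans (n<2^n N) (ℕP.m≤m+n (2 ^ N) _))
  where
  search : ∀ k → N ℕ.< 2 ^ suc k → ∃ λ n → 2 ^ n ℕ.≤ N × N ℕ.< 2 ^ suc n
  search zero    N<2   = 0 , 1≤N , N<2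
  search (suc k) N<2ᵏ⁺² with N ℕP.<? 2 ^ suc k
  ... | yes N<2ᵏ⁺¹ = search k N<2ᵏ⁺¹
  ... | no  N≮2ᵏ⁺¹ = suc k , ℕP.≮⇒≥ N≮2ᵏ⁺¹ , N<2ᵏ⁺²

block : (ℕ → ℚ) → ℕ → ℚ
block f n = sumRange f (2 ^ n) (2 ^ n)

prefix-2^suc : ∀ f n → sumRange f 0 (2 ^ suc n) ≡ sumRange f 0 (2 ^ n) + block f n
prefix-2^suc f n = trans (cong (sumRange f 0) (sym (2^suc n))) (sumRange-++ f 0 (2 ^ n) (2 ^ n))

module _ (η : ℕ → ℚ) where

  private
    0≤∣η∣ : ∀ m → 0ℚ ≤ ∣ η m ∣
    0≤∣η∣ m = ℚP.0≤∣p∣ (η m)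

    x≤y+x : ∀ {x y} → 0ℚ ≤ y → x ≤ y + x
    x≤y+x {x} {y} 0≤y = subst (_≤ y + x) (ℚP.+-identityˡ x) (ℚP.+-monoˡ-≤ x 0≤y)

  sumAbs-nonNeg : ∀ N → 0ℚ ≤ sumAbs η N
  sumAbs-nonNeg N = subst (0ℚ ≤_) (sym (sumAbs≡sumRange η N)) (sumRange-nonNeg 0≤∣η∣ 0 (suc N))

  block-≤-sumAbs : ∀ n N → 2 ^ suc n ℕ.≤ N → block (∣_∣ ∘ η) n ≤ sumAbs η N
  block-≤-sumAbs n N 2ⁿ⁺¹≤N = begin
    block (∣_∣ ∘ η) n                                      ≤⟨ x≤y+x (sumRange-nonNeg 0≤∣η∣ 0 (2 ^ n)) ⟩
    sumRange (∣_∣ ∘ η) 0 (2 ^ n) + block (∣_∣ ∘ η) n        ≡⟨ prefix-2^suc (∣_∣ ∘ η) n ⟨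
    sumRange (∣_∣ ∘ η) 0 (2 ^ suc n)                       ≤⟨ sumRange-mono-len 0≤∣η∣ 0 (ℕP.m≤n⇒m≤1+n 2ⁿ⁺¹≤N) ⟩
    sumRange (∣_∣ ∘ η) 0 (suc N)                           ≡⟨ sumAbs≡sumRange η N ⟨
    sumAbs η N                                             ∎
    where open ℚP.≤-Reasoning

  block-suc-≤-sumAbs : ∀ n N → 2 ^ suc n ℕ.≤ N → block (∣_∣ ∘ η ∘ suc) n ≤ sumAbs η N
  block-suc-≤-sumAbs n N 2ⁿ⁺¹≤N = begin
    block (∣_∣ ∘ η ∘ suc) n                                  ≡⟨ sumRange-shift (∣_∣ ∘ η) (2 ^ n) (2 ^ n) ⟩
    sumRange (∣_∣ ∘ η) (suc (2 ^ n)) (2 ^ n)                 ≤⟨ x≤y+x (sumRange-nonNeg 0≤∣η∣ 0 (suc (2 ^ n))) ⟩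
    sumRange (∣_∣ ∘ η) 0 (suc (2 ^ n)) + sumRange (∣_∣ ∘ η) (suc (2 ^ n)) (2 ^ n)
                                                             ≡⟨ sumRange-++ (∣_∣ ∘ η) 0 (suc (2 ^ n)) (2 ^ n) ⟨
    sumRange (∣_∣ ∘ η) 0 (suc (2 ^ n ℕ.+ 2 ^ n))             ≤⟨ sumRange-mono-len 0≤∣η∣ 0 (s≤s 2ⁿ+2ⁿ≤N) ⟩
    sumRange (∣_∣ ∘ η) 0 (suc N)                             ≡⟨ sumAbs≡sumRange η N ⟨
    sumAbs η N                                               ∎
    where
    open ℚP.≤-Reasoning
    2ⁿ+2ⁿ≤N = subst (ℕ._≤ N) (sym (2^suc n)) 2ⁿ⁺¹≤N

  sumAbs-≤-prefix : ∀ n N → N ℕ.< 2 ^ n → sumAbs η N ≤ sumRange (∣_∣ ∘ η) 0 (2 ^ n)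
  sumAbs-≤-prefix n N N<2ⁿ = subst (_≤ sumRange (∣_∣ ∘ η) 0 (2 ^ n)) (sym (sumAbs≡sumRange η N))
    (sumRange-mono-len 0≤∣η∣ 0 N<2ⁿ)

module BlockGrowth
  (η : ℕ → ℚ)
  (η-double   : ∀ m → η (m ℕ.* 2) ≡ η m)
  (η-double+1 : ∀ m → η (suc (m ℕ.* 2)) ≡ negMean (η m) (η (suc m)))
  (ψ : ℚ → ℚ → ℚ) {μ ν κ C : ℚ}
  (0≤μ : 0ℚ ≤ μ) (0≤ν : 0ℚ ≤ ν) (0<κ : 0ℚ < κ) (0≤C : 0ℚ ≤ C)
  (ψ-split-≥ : ∀ a b → μ * ψ a b ≤ ψ a (negMean a b) + ψ (negMean a b) b)
  (ψ-split-≤ : ∀ a b → ψ a (negMean a b) + ψ (negMean a b) b ≤ ν * ψ a b)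
  (ψ-≥ : ∀ a b → κ * ∣ a ∣ ≤ ψ a b)
  (ψ-≤ : ∀ a b → ψ a b ≤ C * (∣ a ∣ + ∣ b ∣))
  where

  Ψ : ℕ → ℚ
  Ψ m = ψ (η m) (η (suc m))

  ψ-split : ℚ → ℚ → ℚ
  ψ-split a b = ψ a (negMean a b) + ψ (negMean a b) b

  block-Ψ-suc : ∀ n → block Ψ (suc n) ≡ sumRange (λ m → ψ-split (η m) (η (suc m))) (2 ^ n) (2 ^ n)
  block-Ψ-suc n = begin
    sumRange Ψ (2 ^ suc n) (2 ^ suc n)                          ≡⟨ cong₂ (sumRange Ψ) 2ⁿ⁺¹≡2ⁿ*2 2ⁿ⁺¹≡2ⁿ*2 ⟩
    sumRange Ψ (2 ^ n ℕ.* 2) (2 ^ n ℕ.* 2)                      ≡⟨ sumRange-pairs Ψ (2 ^ n) (2 ^ n) ⟩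
    sumRange (λ m → Ψ (m ℕ.* 2) + Ψ (suc (m ℕ.* 2))) (2 ^ n) (2 ^ n) ≡⟨ sumRange-cong pair (2 ^ n) (2 ^ n) ⟩
    sumRange (λ m → ψ-split (η m) (η (suc m))) (2 ^ n) (2 ^ n)  ∎
    where
    open ≡-Reasoning
    2ⁿ⁺¹≡2ⁿ*2 = ℕP.*-comm 2 (2 ^ n)
    pair : ∀ m → Ψ (m ℕ.* 2) + Ψ (suc (m ℕ.* 2)) ≡ ψ-split (η m) (η (suc m))
    pair m = cong₂ _+_ (cong₂ ψ (η-double m) (η-double+1 m)) (cong₂ ψ (η-double+1 m) (η-double (suc m)))

  block-Ψ-≥ : ∀ n → pow μ n * block Ψ 0 ≤ block Ψ n
  block-Ψ-≥ = geometric-lower (block Ψ) 0≤μ step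
    where
    step : ∀ n → μ * block Ψ n ≤ block Ψ (suc n)
    step n = begin
      μ * block Ψ n                                  ≡⟨ sumRange-*ˡ μ Ψ 2ⁿ 2ⁿ ⟨
      sumRange (λ m → μ * Ψ m) 2ⁿ 2ⁿ                 ≤⟨ sumRange-mono (λ m → ψ-split-≥ (η m) (η (suc m))) 2ⁿ 2ⁿ ⟩
      sumRange (λ m → ψ-split (η m) (η (suc m))) 2ⁿ 2ⁿ ≡⟨ block-Ψ-suc n ⟨
      block Ψ (suc n)                                ∎
      where
      open ℚP.≤-Reasoning
      2ⁿ = 2 ^ n

  block-Ψ-≤ : ∀ n → block Ψ n ≤ pow ν n * block Ψ 0
  block-Ψ-≤ = geometric-upper (block Ψ) 0≤ν step
    where
    step : ∀ n → block Ψ (suc n) ≤ ν * block Ψ n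
    step n = begin
      block Ψ (suc n)                                ≡⟨ block-Ψ-suc n ⟩
      sumRange (λ m → ψ-split (η m) (η (suc m))) 2ⁿ 2ⁿ ≤⟨ sumRange-mono (λ m → ψ-split-≤ (η m) (η (suc m))) 2ⁿ 2ⁿ ⟩
      sumRange (λ m → ν * Ψ m) 2ⁿ 2ⁿ                 ≡⟨ sumRange-*ˡ ν Ψ 2ⁿ 2ⁿ ⟩
      ν * block Ψ n                                  ∎
      where
      open ℚP.≤-Reasoning
      2ⁿ = 2 ^ n

  κ*block-∣η∣≤block-Ψ : ∀ n → κ * block (∣_∣ ∘ η) n ≤ block Ψ n
  κ*block-∣η∣≤block-Ψ n = subst (_≤ block Ψ n) (sumRange-*ˡ κ (∣_∣ ∘ η) (2 ^ n) (2 ^ n))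
    (sumRange-mono (λ m → ψ-≥ (η m) (η (suc m))) (2 ^ n) (2 ^ n))

  block-Ψ≤C*blocks : ∀ n → block Ψ n ≤ C * (block (∣_∣ ∘ η) n + block (∣_∣ ∘ η ∘ suc) n)
  block-Ψ≤C*blocks n = begin
    block Ψ n                                              ≤⟨ sumRange-mono (λ m → ψ-≤ (η m) (η (suc m))) 2ⁿ 2ⁿ ⟩
    sumRange (λ m → C * (∣ η m ∣ + ∣ η (suc m) ∣)) 2ⁿ 2ⁿ   ≡⟨ sumRange-*ˡ C _ 2ⁿ 2ⁿ ⟩
    C * sumRange (λ m → ∣ η m ∣ + ∣ η (suc m) ∣) 2ⁿ 2ⁿ     ≡⟨ cong (C *_) (sumRange-+ (∣_∣ ∘ η) (∣_∣ ∘ η ∘ suc) 2ⁿ 2ⁿ) ⟩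
    C * (block (∣_∣ ∘ η) n + block (∣_∣ ∘ η ∘ suc) n)      ∎
    where
    open ℚP.≤-Reasoning
    2ⁿ = 2 ^ n

  sumAbs-≥-μⁿ : ∀ n N → 2 ^ suc n ℕ.≤ N → pow μ n * block Ψ 0 ≤ (C + C) * sumAbs η N
  sumAbs-≥-μⁿ n N 2ⁿ⁺¹≤N = begin
    pow μ n * block Ψ 0                                   ≤⟨ block-Ψ-≥ n ⟩
    block Ψ n                                             ≤⟨ block-Ψ≤C*blocks n ⟩
    C * (block (∣_∣ ∘ η) n + block (∣_∣ ∘ η ∘ suc) n)      ≤⟨ ℚP.*-monoˡ-≤-nonNeg C {{ℚ.nonNegative 0≤C}}
                                                               (ℚP.+-mono-≤ (block-≤-sumAbs η n N 2ⁿ⁺¹≤N)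
                                                                            (block-suc-≤-sumAbs η n N 2ⁿ⁺¹≤N)) ⟩
    C * (sumAbs η N + sumAbs η N)                         ≡⟨ ℚP.*-distribˡ-+ C (sumAbs η N) (sumAbs η N) ⟩
    C * sumAbs η N + C * sumAbs η N                       ≡⟨ ℚP.*-distribʳ-+ (sumAbs η N) C C ⟨
    (C + C) * sumAbs η N                                  ∎
    where open ℚP.≤-Reasoning

  prefix-≤ : ∀ {D} → sumRange (∣_∣ ∘ η) 0 1 ≤ D → κ * D + block Ψ 0 ≤ κ * D * ν →
             ∀ n → sumRange (∣_∣ ∘ η) 0 (2 ^ n) ≤ D * pow ν n
  prefix-≤ {D} P₀≤D growth n = ℚP.*-cancelˡ-≤-pos κ {{ℚ.positive 0<κ}} (begin
    κ * P n               ≤⟨ partial-sums-geometric (λ n → κ * P n) (λ n → κ * block (∣_∣ ∘ η) n) 0≤ν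
                               step κ*block≤ (ℚP.*-monoˡ-≤-nonNeg κ {{ℚ.nonNegative (ℚP.<⇒≤ 0<κ)}} P₀≤D) growth n ⟩
    κ * D * pow ν n       ≡⟨ ℚP.*-assoc κ D (pow ν n) ⟩
    κ * (D * pow ν n)     ∎)
    where
    open ℚP.≤-Reasoning
    P : ℕ → ℚ
    P n = sumRange (∣_∣ ∘ η) 0 (2 ^ n)
    step : ∀ n → κ * P (suc n) ≤ κ * P n + κ * block (∣_∣ ∘ η) n
    step n = ℚP.≤-reflexive (trans (cong (κ *_) (prefix-2^suc (∣_∣ ∘ η) n)) (ℚP.*-distribˡ-+ κ (P n) _))
    κ*block≤ : ∀ n → κ * block (∣_∣ ∘ η) n ≤ block Ψ 0 * pow ν n
    κ*block≤ n = ℚP.≤-trans (κ*block-∣η∣≤block-Ψ n)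
                  (ℚP.≤-trans (block-Ψ-≤ n) (ℚP.≤-reflexive (ℚP.*-comm (pow ν n) (block Ψ 0))))

-- Fractional powers and the integer part

x^[p/q+1]≤y⇒x^[a/d]≤y : ∀ {x y} a d p q → 1ℚ ≤ x → 0ℚ ≤ y →
  pow x p ≤ pow y (suc q) → a ℕ.* suc q ℕ.≤ p ℕ.* d → pow x a ≤ pow y d
x^[p/q+1]≤y⇒x^[a/d]≤y {x} {y} a d p q 1≤x 0≤y xᵖ≤yᵠ⁺¹ a[q+1]≤pd = pow-cancelˡ-≤ q (pow-nonNeg d 0≤y) (begin
  pow (pow x a) (suc q)     ≡⟨ pow-pow x a (suc q) ⟩
  pow x (a ℕ.* suc q)       ≤⟨ pow-monoʳ-≤ 1≤x a[q+1]≤pd ⟩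
  pow x (p ℕ.* d)           ≡⟨ pow-pow x p d ⟨
  pow (pow x p) d           ≤⟨ pow-monoˡ-≤ d (pow-nonNeg p (ℚP.≤-trans compute-≤ 1≤x)) xᵖ≤yᵠ⁺¹ ⟩
  pow (pow y (suc q)) d     ≡⟨ pow-comm y (suc q) d ⟩
  pow (pow y d) (suc q)     ∎)
  where open ℚP.≤-Reasoning

y≤x^[p/q+1]⇒y^[d/b]≤x : ∀ {x y} b d p q → 1ℚ ≤ x → 0ℚ ≤ y →
  pow y (suc q) ≤ pow x p → p ℕ.* d ℕ.≤ b ℕ.* suc q → pow y d ≤ pow x b
y≤x^[p/q+1]⇒y^[d/b]≤x {x} {y} b d p q 1≤x 0≤y yᵠ⁺¹≤xᵖ pd≤b[q+1] = pow-cancelˡ-≤ q (pow-nonNeg b 0≤x) (begin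
  pow (pow y d) (suc q)     ≡⟨ pow-comm y d (suc q) ⟩
  pow (pow y (suc q)) d     ≤⟨ pow-monoˡ-≤ d (pow-nonNeg (suc q) 0≤y) yᵠ⁺¹≤xᵖ ⟩
  pow (pow x p) d           ≡⟨ pow-pow x p d ⟩
  pow x (p ℕ.* d)           ≤⟨ pow-monoʳ-≤ 1≤x pd≤b[q+1] ⟩
  pow x (b ℕ.* suc q)       ≡⟨ pow-pow x b (suc q) ⟨
  pow (pow x b) (suc q)     ∎)
  where
  open ℚP.≤-Reasoning
  0≤x = ℚP.≤-trans compute-≤ 1≤x

lowerBy-dyadic : ∀ {c μ r x S} a d n → 0ℚ ≤ c → 0ℚ ≤ μ → 0ℚ ≤ r → 0ℚ ≤ x →
  pow r a ≤ pow μ d → x ≤ pow r n → c * pow μ n ≤ S → LowerBy c x a d S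
lowerBy-dyadic {c} {μ} {r} {x} {S} a d n 0≤c 0≤μ 0≤r 0≤x rᵃ≤μᵈ x≤rⁿ cμⁿ≤S = begin
  pow c d * pow x a                 ≤⟨ ℚP.*-monoˡ-≤-nonNeg (pow c d) {{ℚ.nonNegative (pow-nonNeg d 0≤c)}} xᵃ≤[μⁿ]ᵈ ⟩
  pow c d * pow (pow μ n) d         ≡⟨ pow-*-distrib c (pow μ n) d ⟨
  pow (c * pow μ n) d               ≤⟨ pow-monoˡ-≤ d (nonNeg*nonNeg 0≤c (pow-nonNeg n 0≤μ)) cμⁿ≤S ⟩
  pow S d                           ∎
  where
  open ℚP.≤-Reasoning
  xᵃ≤[μⁿ]ᵈ : pow x a ≤ pow (pow μ n) d
  xᵃ≤[μⁿ]ᵈ = begin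
    pow x a                         ≤⟨ pow-monoˡ-≤ a 0≤x x≤rⁿ ⟩
    pow (pow r n) a                 ≡⟨ pow-comm r n a ⟩
    pow (pow r a) n                 ≤⟨ pow-monoˡ-≤ n (pow-nonNeg a 0≤r) rᵃ≤μᵈ ⟩
    pow (pow μ d) n                 ≡⟨ pow-comm μ d n ⟩
    pow (pow μ n) d                 ∎

upperBy-dyadic : ∀ {c ν r x S} b d n → 0ℚ ≤ S → 0ℚ ≤ c → 0ℚ ≤ ν → 0ℚ ≤ r →
  pow ν d ≤ pow r b → pow r n ≤ x → S ≤ c * pow ν n → UpperBy c x b d S
upperBy-dyadic {c} {ν} {r} {x} {S} b d n 0≤S 0≤c 0≤ν 0≤r νᵈ≤rᵇ rⁿ≤x S≤cνⁿ = begin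
  pow S d                           ≤⟨ pow-monoˡ-≤ d 0≤S S≤cνⁿ ⟩
  pow (c * pow ν n) d               ≡⟨ pow-*-distrib c (pow ν n) d ⟩
  pow c d * pow (pow ν n) d         ≤⟨ ℚP.*-monoˡ-≤-nonNeg (pow c d) {{ℚ.nonNegative (pow-nonNeg d 0≤c)}} [νⁿ]ᵈ≤xᵇ ⟩
  pow c d * pow x b                 ∎
  where
  open ℚP.≤-Reasoning
  [νⁿ]ᵈ≤xᵇ : pow (pow ν n) d ≤ pow x b
  [νⁿ]ᵈ≤xᵇ = begin
    pow (pow ν n) d                 ≡⟨ pow-comm ν n d ⟩
    pow (pow ν d) n                 ≤⟨ pow-monoˡ-≤ n (pow-nonNeg d 0≤ν) νᵈ≤rᵇ ⟩
    pow (pow r b) n                 ≡⟨ pow-comm r b n ⟩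
    pow (pow r n) b                 ≤⟨ pow-monoˡ-≤ b (pow-nonNeg n 0≤r) rⁿ≤x ⟩
    pow x b                         ∎

floorℕ-bounds : ∀ x → 0ℚ ≤ x → + floorℕ x ℤ.* ℚ.↧ x ℤ.≤ ℚ.↥ x × ℚ.↥ x ℤ.< + suc (floorℕ x) ℤ.* ℚ.↧ x
floorℕ-bounds (mkℚ a d _) 0≤x = subst (λ z → z ℤ.* + suc d ℤ.≤ a) (sym +⌊x⌋≡q) (ℤD.[n/ℕd]*d≤n a (suc d))
                              , subst (λ z → a ℤ.< ℤ.suc z ℤ.* + suc d) (sym +⌊x⌋≡q) (ℤD.n<s[n/ℕd]*d a (suc d))
  where
  0≤a : + 0 ℤ.≤ a
  0≤a = subst (+ 0 ℤ.≤_) (ℤP.*-identityʳ a) (ℚP.drop-*≤* 0≤x)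
  +⌊x⌋≡q : + ℤ.∣ a ℤ./ + suc d ∣ ≡ a ℤ./ℕ suc d
  +⌊x⌋≡q = trans (cong (λ z → + ℤ.∣ z ∣) (ℤD.div-pos-is-/ℕ a (suc d))) (ℤP.0≤i⇒+∣i∣≡i (ℤD.0≤n⇒0≤n/ℕd a (suc d) 0≤a))

-- fromℤ rather than _/ 1, so that ↥ and ↧ of ℕ→ℚ k compute.
ℕ→ℚ : ℕ → ℚ
ℕ→ℚ k = fromℤ (+ k)

ℕ→ℚ-* : ∀ m n → ℕ→ℚ m * ℕ→ℚ n ≡ ℕ→ℚ (m ℕ.* n)
ℕ→ℚ-* m n = ℚP.toℚᵘ-injective (ℚᵘP.≃-trans (ℚP.toℚᵘ-homo-* (ℕ→ℚ m) (ℕ→ℚ n))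
  (*≡* (cong₂ ℤ._*_ (sym (ℤP.pos-* m n)) refl)))

pow-ℕ→ℚ : ∀ k n → pow (ℕ→ℚ k) n ≡ ℕ→ℚ (k ^ n)
pow-ℕ→ℚ k zero    = refl
pow-ℕ→ℚ k (suc n) = trans (cong (ℕ→ℚ k *_) (pow-ℕ→ℚ k n)) (ℕ→ℚ-* k (k ^ n))

≤-floorℕ⇒≤ : ∀ {x k} → 0ℚ ≤ x → k ℕ.≤ floorℕ x → ℕ→ℚ k ≤ x
≤-floorℕ⇒≤ {x@(mkℚ a d _)} {k} 0≤x k≤⌊x⌋ = ℚ.*≤* (begin
  + k ℤ.* + suc d         ≤⟨ ℤP.*-monoʳ-≤-nonNeg (+ suc d) (+≤+ k≤⌊x⌋) ⟩
  + floorℕ x ℤ.* + suc d  ≤⟨ floorℕ-bounds x 0≤x .proj₁ ⟩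
  a                       ≡⟨ ℤP.*-identityʳ a ⟨
  a ℤ.* + 1               ∎)
  where open ℤP.≤-Reasoning

floorℕ<⇒< : ∀ {x k} → 0ℚ ≤ x → floorℕ x ℕ.< k → x < ℕ→ℚ k
floorℕ<⇒< {x@(mkℚ a d _)} {k} 0≤x ⌊x⌋<k = ℚ.*<* (begin-strict
  a ℤ.* + 1                     ≡⟨ ℤP.*-identityʳ a ⟩
  a                             <⟨ floorℕ-bounds x 0≤x .proj₂ ⟩
  + suc (floorℕ x) ℤ.* + suc d  ≤⟨ ℤP.*-monoʳ-≤-nonNeg (+ suc d) (+≤+ ⌊x⌋<k) ⟩
  + k ℤ.* + suc d               ∎)
  where open ℤP.≤-Reasoning

1≤floorℕ : ∀ {x} → 1ℚ ≤ x → 1 ℕ.≤ floorℕ x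
1≤floorℕ 1≤x = ℕP.≮⇒≥ λ ⌊x⌋<1 → ℚP.<-irrefl refl (ℚP.<-≤-trans (floorℕ<⇒< (ℚP.≤-trans compute-≤ 1≤x) ⌊x⌋<1) 1≤x)

two : ℚ
two = ℕ→ℚ 2

dyadic-bracket : ∀ {x} → 1ℚ ≤ x → ∃ λ n →
  2 ^ n ℕ.≤ floorℕ x × floorℕ x ℕ.< 2 ^ suc n × pow two n ≤ x × x ≤ pow two (suc n)
dyadic-bracket {x} 1≤x =
  let 0≤x = ℚP.≤-trans compute-≤ 1≤x
      (n , 2ⁿ≤⌊x⌋ , ⌊x⌋<2ⁿ⁺¹) = dyadic-block (floorℕ x) (1≤floorℕ 1≤x)
  in n , 2ⁿ≤⌊x⌋ , ⌊x⌋<2ⁿ⁺¹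
       , subst (_≤ x) (sym (pow-ℕ→ℚ 2 n)) (≤-floorℕ⇒≤ 0≤x 2ⁿ≤⌊x⌋)
       , ℚP.<⇒≤ (subst (x <_) (sym (pow-ℕ→ℚ 2 (suc n))) (floorℕ<⇒< 0≤x ⌊x⌋<2ⁿ⁺¹))

-- Weighted sums of absolute values of linear forms

Form : Set
Form = ℚ × ℚ × ℚ

⟦_⟧ : List Form → ℚ → ℚ → ℚ
⟦ [] ⟧                 a b = 0ℚ
⟦ (c , p , q) ∷ fs ⟧ a b = c * ∣ p * a + q * b ∣ + ⟦ fs ⟧ a b

scale : ℚ → List Form → List Form
scale k = map λ (c , p , q) → (k * c , p , q)

_⊖_ : List Form → List Form → List Form
gs ⊖ fs = gs ++ scale (- 1ℚ) fs

substitute : ℚ → ℚ → ℚ → ℚ → List Form → List Form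
substitute α β γ δ = map λ (c , p , q) → (c , p * α + q * γ , p * β + q * δ)

swap : List Form → List Form
swap = substitute 0ℚ 1ℚ 1ℚ 0ℚ

split : List Form → List Form
split fs = substitute 1ℚ 0ℚ (- ½) (- ½) fs ++ substitute (- ½) (- ½) 0ℚ 1ℚ fs

⟦++⟧ : ∀ gs fs a b → ⟦ gs ++ fs ⟧ a b ≡ ⟦ gs ⟧ a b + ⟦ fs ⟧ a b
⟦++⟧ []                 fs a b = sym (ℚP.+-identityˡ _)
⟦++⟧ ((c , p , q) ∷ gs) fs a b =
  trans (cong (_+_ (c * ∣ p * a + q * b ∣)) (⟦++⟧ gs fs a b))
        (sym (ℚP.+-assoc (c * ∣ p * a + q * b ∣) (⟦ gs ⟧ a b) (⟦ fs ⟧ a b)))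

⟦scale⟧ : ∀ k fs a b → ⟦ scale k fs ⟧ a b ≡ k * ⟦ fs ⟧ a b
⟦scale⟧ k []                 a b = sym (ℚP.*-zeroʳ k)
⟦scale⟧ k ((c , p , q) ∷ fs) a b =
  trans (cong₂ _+_ (ℚP.*-assoc k c _) (⟦scale⟧ k fs a b)) (sym (ℚP.*-distribˡ-+ k _ _))

⟦⊖⟧ : ∀ gs fs a b → ⟦ gs ⊖ fs ⟧ a b ≡ ⟦ gs ⟧ a b - ⟦ fs ⟧ a b
⟦⊖⟧ gs fs a b = trans (⟦++⟧ gs _ a b)
  (trans (cong (_+_ (⟦ gs ⟧ a b)) (⟦scale⟧ (- 1ℚ) fs a b)) (ring (⟦ gs ⟧ a b) (⟦ fs ⟧ a b)))
  where
  ring : ∀ x y → x + - 1ℚ * y ≡ x - y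
  ring = solve-∀ ℚ-ring

⟦substitute⟧ : ∀ α β γ δ fs a b → ⟦ substitute α β γ δ fs ⟧ a b ≡ ⟦ fs ⟧ (α * a + β * b) (γ * a + δ * b)
⟦substitute⟧ α β γ δ []                 a b = refl
⟦substitute⟧ α β γ δ ((c , p , q) ∷ fs) a b =
  cong₂ (λ x y → c * ∣ x ∣ + y) (ring α β γ δ p q a b) (⟦substitute⟧ α β γ δ fs a b)
  where
  ring : ∀ α β γ δ p q a b → (p * α + q * γ) * a + (p * β + q * δ) * b ≡ p * (α * a + β * b) + q * (γ * a + δ * b)
  ring = solve-∀ ℚ-ring

1*a+0*b≡a : ∀ a b → 1ℚ * a + 0ℚ * b ≡ a
1*a+0*b≡a = solve-∀ ℚ-ring

0*a+1*b≡b : ∀ a b → 0ℚ * a + 1ℚ * b ≡ b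
0*a+1*b≡b = solve-∀ ℚ-ring

⟦swap⟧ : ∀ fs a b → ⟦ swap fs ⟧ a b ≡ ⟦ fs ⟧ b a
⟦swap⟧ fs a b = trans (⟦substitute⟧ 0ℚ 1ℚ 1ℚ 0ℚ fs a b) (cong₂ ⟦ fs ⟧ (0*a+1*b≡b a b) (1*a+0*b≡a a b))

⟦split⟧ : ∀ fs a b → ⟦ split fs ⟧ a b ≡ ⟦ fs ⟧ a (negMean a b) + ⟦ fs ⟧ (negMean a b) b
⟦split⟧ fs a b = begin
  ⟦ split fs ⟧ a b
    ≡⟨ ⟦++⟧ (substitute 1ℚ 0ℚ (- ½) (- ½) fs) _ a b ⟩
  ⟦ substitute 1ℚ 0ℚ (- ½) (- ½) fs ⟧ a b + ⟦ substitute (- ½) (- ½) 0ℚ 1ℚ fs ⟧ a b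
    ≡⟨ cong₂ _+_ (⟦substitute⟧ 1ℚ 0ℚ (- ½) (- ½) fs a b) (⟦substitute⟧ (- ½) (- ½) 0ℚ 1ℚ fs a b) ⟩
  ⟦ fs ⟧ (1ℚ * a + 0ℚ * b) (- ½ * a + - ½ * b) + ⟦ fs ⟧ (- ½ * a + - ½ * b) (0ℚ * a + 1ℚ * b)
    ≡⟨ cong₂ _+_ (cong₂ ⟦ fs ⟧ (1*a+0*b≡a a b) (ring ½ a b)) (cong₂ ⟦ fs ⟧ (ring ½ a b) (0*a+1*b≡b a b)) ⟩
  ⟦ fs ⟧ a (negMean a b) + ⟦ fs ⟧ (negMean a b) b
    ∎
  where
  open ≡-Reasoning
  ring : ∀ h a b → - h * a + - h * b ≡ - (h * (a + b))
  ring = solve-∀ ℚ-ring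

⟦⟧-neg : ∀ fs a b → ⟦ fs ⟧ (- a) (- b) ≡ ⟦ fs ⟧ a b
⟦⟧-neg []                 a b = refl
⟦⟧-neg ((c , p , q) ∷ fs) a b =
  cong₂ _+_ (cong (c *_) (trans (cong ∣_∣ (ring p a q b)) (ℚP.∣-p∣≡∣p∣ _))) (⟦⟧-neg fs a b)
  where
  ring : ∀ p a q b → p * - a + q * - b ≡ - (p * a + q * b)
  ring = solve-∀ ℚ-ring

NonNegWeights : List Form → Set
NonNegWeights = All λ (c , _ , _) → 0ℚ ≤ c

nonNegWeights? : ∀ fs → Dec (NonNegWeights fs)
nonNegWeights? = All.all? λ (c , _ , _) → 0ℚ ℚP.≤? c

⟦⟧-nonNeg : ∀ {fs} → NonNegWeights fs → ∀ a b → 0ℚ ≤ ⟦ fs ⟧ a b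
⟦⟧-nonNeg []          a b = ℚP.≤-refl
⟦⟧-nonNeg (0≤c ∷ 0≤w) a b = ℚP.+-mono-≤ (nonNeg*nonNeg 0≤c (ℚP.0≤∣p∣ _)) (⟦⟧-nonNeg 0≤w a b)

⟦⟧-≥-head : ∀ {c p q fs} → NonNegWeights fs → ∀ a b → c * ∣ p * a + q * b ∣ ≤ ⟦ (c , p , q) ∷ fs ⟧ a b
⟦⟧-≥-head {c} {p} {q} {fs} 0≤w a b =
  subst (_≤ ⟦ (c , p , q) ∷ fs ⟧ a b) (ℚP.+-identityʳ _) (ℚP.+-monoʳ-≤ (c * ∣ p * a + q * b ∣) (⟦⟧-nonNeg 0≤w a b))

ℓ¹-weight : List Form → ℚ
ℓ¹-weight []                 = 0ℚ
ℓ¹-weight ((c , p , q) ∷ fs) = c * (∣ p ∣ + ∣ q ∣) + ℓ¹-weight fs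

∣pa+qb∣≤ℓ¹ : ∀ p q a b → ∣ p * a + q * b ∣ ≤ (∣ p ∣ + ∣ q ∣) * (∣ a ∣ + ∣ b ∣)
∣pa+qb∣≤ℓ¹ p q a b = begin
  ∣ p * a + q * b ∣                                      ≤⟨ ℚP.∣p+q∣≤∣p∣+∣q∣ (p * a) (q * b) ⟩
  ∣ p * a ∣ + ∣ q * b ∣                                  ≡⟨ cong₂ _+_ (ℚP.∣p*q∣≡∣p∣*∣q∣ p a) (ℚP.∣p*q∣≡∣p∣*∣q∣ q b) ⟩
  ∣ p ∣ * ∣ a ∣ + ∣ q ∣ * ∣ b ∣                          ≡⟨ ℚP.+-identityʳ _ ⟨
  ∣ p ∣ * ∣ a ∣ + ∣ q ∣ * ∣ b ∣ + 0ℚ                     ≤⟨ ℚP.+-monoʳ-≤ (∣ p ∣ * ∣ a ∣ + ∣ q ∣ * ∣ b ∣) cross≥0 ⟩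
  ∣ p ∣ * ∣ a ∣ + ∣ q ∣ * ∣ b ∣ + (∣ p ∣ * ∣ b ∣ + ∣ q ∣ * ∣ a ∣) ≡⟨ ring (∣ p ∣) (∣ q ∣) (∣ a ∣) (∣ b ∣) ⟩
  (∣ p ∣ + ∣ q ∣) * (∣ a ∣ + ∣ b ∣)                      ∎
  where
  open ℚP.≤-Reasoning
  cross≥0 = ℚP.+-mono-≤ (nonNeg*nonNeg (ℚP.0≤∣p∣ p) (ℚP.0≤∣p∣ b)) (nonNeg*nonNeg (ℚP.0≤∣p∣ q) (ℚP.0≤∣p∣ a))
  ring : ∀ P Q A B → P * A + Q * B + (P * B + Q * A) ≡ (P + Q) * (A + B)
  ring = solve-∀ ℚ-ring

⟦⟧-≤-ℓ¹ : ∀ {fs} → NonNegWeights fs → ∀ a b → ⟦ fs ⟧ a b ≤ ℓ¹-weight fs * (∣ a ∣ + ∣ b ∣)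
⟦⟧-≤-ℓ¹ {[]}                 []          a b = ℚP.≤-reflexive (sym (ℚP.*-zeroˡ (∣ a ∣ + ∣ b ∣)))
⟦⟧-≤-ℓ¹ {(c , p , q) ∷ fs} (0≤c ∷ 0≤w) a b = begin
  c * ∣ p * a + q * b ∣ + ⟦ fs ⟧ a b
    ≤⟨ ℚP.+-mono-≤ (ℚP.*-monoˡ-≤-nonNeg c {{ℚ.nonNegative 0≤c}} (∣pa+qb∣≤ℓ¹ p q a b)) (⟦⟧-≤-ℓ¹ 0≤w a b) ⟩
  c * ((∣ p ∣ + ∣ q ∣) * (∣ a ∣ + ∣ b ∣)) + ℓ¹-weight fs * (∣ a ∣ + ∣ b ∣)
    ≡⟨ ring c (∣ p ∣ + ∣ q ∣) (ℓ¹-weight fs) (∣ a ∣ + ∣ b ∣) ⟩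
  (c * (∣ p ∣ + ∣ q ∣) + ℓ¹-weight fs) * (∣ a ∣ + ∣ b ∣)
    ∎
  where
  open ℚP.≤-Reasoning
  ring : ∀ c P W S → c * (P * S) + W * S ≡ (c * P + W) * S
  ring = solve-∀ ℚ-ring

SameSign : ℚ → ℚ → Set
SameSign u v = (0ℚ ≤ u × 0ℚ ≤ v) ⊎ (u ≤ 0ℚ × v ≤ 0ℚ)

∣-∣-additive : ∀ {u v α β} → SameSign u v → 0ℚ ≤ α → 0ℚ ≤ β → ∣ α * u + β * v ∣ ≡ α * ∣ u ∣ + β * ∣ v ∣
∣-∣-additive {u} {v} {α} {β} (inj₁ (0≤u , 0≤v)) 0≤α 0≤β = begin
  ∣ α * u + β * v ∣        ≡⟨ ℚP.0≤p⇒∣p∣≡p (ℚP.+-mono-≤ (nonNeg*nonNeg 0≤α 0≤u) (nonNeg*nonNeg 0≤β 0≤v)) ⟩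
  α * u + β * v            ≡⟨ cong₂ (λ x y → α * x + β * y) (ℚP.0≤p⇒∣p∣≡p 0≤u) (ℚP.0≤p⇒∣p∣≡p 0≤v) ⟨
  α * ∣ u ∣ + β * ∣ v ∣    ∎
  where open ≡-Reasoning
∣-∣-additive {u} {v} {α} {β} (inj₂ (u≤0 , v≤0)) 0≤α 0≤β = begin
  ∣ α * u + β * v ∣        ≡⟨ trans (cong ∣_∣ (ring α u β v)) (ℚP.∣-p∣≡∣p∣ _) ⟨
  ∣ α * - u + β * - v ∣    ≡⟨ ∣-∣-additive (inj₁ (ℚP.neg-antimono-≤ u≤0 , ℚP.neg-antimono-≤ v≤0)) 0≤α 0≤β ⟩
  α * ∣ - u ∣ + β * ∣ - v ∣  ≡⟨ cong₂ (λ x y → α * x + β * y) (ℚP.∣-p∣≡∣p∣ u) (ℚP.∣-p∣≡∣p∣ v) ⟩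
  α * ∣ u ∣ + β * ∣ v ∣    ∎
  where
  open ≡-Reasoning
  ring : ∀ α u β v → α * - u + β * - v ≡ - (α * u + β * v)
  ring = solve-∀ ℚ-ring

SignsConstantOn : List Form → ℚ → ℚ → Set
SignsConstantOn fs x y = All (λ (_ , p , q) → SameSign (p * 1ℚ + q * x) (p * 1ℚ + q * y)) fs

⟦⟧-interpolate : ∀ {fs x y a b} → SignsConstantOn fs x y → 0ℚ ≤ y - x → 0ℚ ≤ y * a - b → 0ℚ ≤ b - x * a →
  (y - x) * ⟦ fs ⟧ a b ≡ (y * a - b) * ⟦ fs ⟧ 1ℚ x + (b - x * a) * ⟦ fs ⟧ 1ℚ y
⟦⟧-interpolate {[]} {x} {y} {a} {b} [] _ _ _ = ring (y - x) (y * a - b) (b - x * a)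
  where
  ring : ∀ k α β → k * 0ℚ ≡ α * 0ℚ + β * 0ℚ
  ring = solve-∀ ℚ-ring
⟦⟧-interpolate {(c , p , q) ∷ fs} {x} {y} {a} {b} (same ∷ sames) 0≤y-x 0≤α 0≤β = begin
  (y - x) * (c * ∣ p * a + q * b ∣ + ⟦ fs ⟧ a b)
    ≡⟨ ℚP.*-distribˡ-+ (y - x) _ _ ⟩
  (y - x) * (c * ∣ p * a + q * b ∣) + (y - x) * ⟦ fs ⟧ a b
    ≡⟨ cong₂ _+_ head (⟦⟧-interpolate sames 0≤y-x 0≤α 0≤β) ⟩
  c * (α * ∣ u ∣ + β * ∣ v ∣) + (α * ⟦ fs ⟧ 1ℚ x + β * ⟦ fs ⟧ 1ℚ y)
    ≡⟨ ring₁ c α β (∣ u ∣) (∣ v ∣) (⟦ fs ⟧ 1ℚ x) (⟦ fs ⟧ 1ℚ y) ⟩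
  α * (c * ∣ u ∣ + ⟦ fs ⟧ 1ℚ x) + β * (c * ∣ v ∣ + ⟦ fs ⟧ 1ℚ y)
    ∎
  where
  open ≡-Reasoning
  α = y * a - b
  β = b - x * a
  u = p * 1ℚ + q * x
  v = p * 1ℚ + q * y
  ring₁ : ∀ c α β U V X Y → c * (α * U + β * V) + (α * X + β * Y) ≡ α * (c * U + X) + β * (c * V + Y)
  ring₁ = solve-∀ ℚ-ring
  ring₂ : ∀ x y a b p q → (y - x) * (p * a + q * b) ≡ (y * a - b) * (p * 1ℚ + q * x) + (b - x * a) * (p * 1ℚ + q * y)
  ring₂ = solve-∀ ℚ-ring
  ring₃ : ∀ k c w → k * (c * w) ≡ c * (k * w)
  ring₃ = solve-∀ ℚ-ring
  head : (y - x) * (c * ∣ p * a + q * b ∣) ≡ c * (α * ∣ u ∣ + β * ∣ v ∣)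
  head = begin
    (y - x) * (c * ∣ p * a + q * b ∣)     ≡⟨ ring₃ (y - x) c _ ⟩
    c * ((y - x) * ∣ p * a + q * b ∣)     ≡⟨ cong (λ k → c * (k * ∣ p * a + q * b ∣)) (ℚP.0≤p⇒∣p∣≡p 0≤y-x) ⟨
    c * (∣ y - x ∣ * ∣ p * a + q * b ∣)   ≡⟨ cong (c *_) (ℚP.∣p*q∣≡∣p∣*∣q∣ (y - x) _) ⟨
    c * ∣ (y - x) * (p * a + q * b) ∣     ≡⟨ cong (λ w → c * ∣ w ∣) (ring₂ x y a b p q) ⟩
    c * ∣ α * u + β * v ∣                 ≡⟨ cong (c *_) (∣-∣-additive same 0≤α 0≤β) ⟩
    c * (α * ∣ u ∣ + β * ∣ v ∣)           ∎

AffineOn : List Form → ℚ → ℚ → Set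
AffineOn fs x y = x < y × SignsConstantOn fs x y

nonNeg-on-segment : ∀ {fs x y a b} → AffineOn fs x y → 0ℚ ≤ ⟦ fs ⟧ 1ℚ x → 0ℚ ≤ ⟦ fs ⟧ 1ℚ y →
                    x * a ≤ b → b ≤ y * a → 0ℚ ≤ ⟦ fs ⟧ a b
nonNeg-on-segment {fs} {x} {y} {a} {b} (x<y , sames) 0≤fx 0≤fy xa≤b b≤ya =
  ℚP.*-cancelˡ-≤-pos (y - x) {{ℚ.positive 0<y-x}} (begin
    (y - x) * 0ℚ                                                  ≡⟨ ℚP.*-zeroʳ (y - x) ⟩
    0ℚ                                                            ≤⟨ ℚP.+-mono-≤ (nonNeg*nonNeg 0≤α 0≤fx) (nonNeg*nonNeg 0≤β 0≤fy) ⟩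
    (y * a - b) * ⟦ fs ⟧ 1ℚ x + (b - x * a) * ⟦ fs ⟧ 1ℚ y        ≡⟨ ⟦⟧-interpolate sames (ℚP.<⇒≤ 0<y-x) 0≤α 0≤β ⟨
    (y - x) * ⟦ fs ⟧ a b                                          ∎)
  where
  open ℚP.≤-Reasoning
  0<y-x = subst (_< y - x) (ℚP.+-inverseʳ x) (ℚP.+-monoˡ-< (- x) x<y)
  0≤α = p≤q⇒0≤q-p b≤ya
  0≤β = p≤q⇒0≤q-p xa≤b

Certificate : List Form → List ℚ → Set
Certificate fs ss = All (λ s → 0ℚ ≤ ⟦ fs ⟧ 1ℚ s) ss × Linked (AffineOn fs) ss

nonNeg-between : ∀ {fs a b} x ys z → Certificate fs (x ∷ ys ++ [ z ]) → x * a ≤ b → b ≤ z * a → 0ℚ ≤ ⟦ fs ⟧ a b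
nonNeg-between x []       z (0≤fx ∷ 0≤fz ∷ [] , seg ∷ [-]) xa≤b b≤za = nonNeg-on-segment seg 0≤fx 0≤fz xa≤b b≤za
nonNeg-between {a = a} {b} x (y ∷ ys) z (0≤fx ∷ 0≤fs , seg ∷ segs) xa≤b b≤za with b ℚP.≤? y * a
... | yes b≤ya = nonNeg-on-segment seg 0≤fx (All.head 0≤fs) xa≤b b≤ya
... | no  b≰ya = nonNeg-between y ys z (0≤fs , segs) (ℚP.<⇒≤ (ℚP.≰⇒> b≰ya)) b≤za

ConeNonNeg : List Form → Set
ConeNonNeg fs = ∀ a b → - a ≤ b → b ≤ a → 0ℚ ≤ ⟦ fs ⟧ a b

certified-cone : ∀ {fs} ys → Certificate fs (- 1ℚ ∷ ys ++ [ 1ℚ ]) → ConeNonNeg fs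
certified-cone ys cert a b -a≤b b≤a =
  nonNeg-between (- 1ℚ) ys 1ℚ cert (subst (_≤ b) (sym (-1*a≡-a a)) -a≤b) (subst (b ≤_) (sym (ℚP.*-identityˡ a)) b≤a)
  where
  -1*a≡-a : ∀ a → - 1ℚ * a ≡ - a
  -1*a≡-a = solve-∀ ℚ-ring

nonNeg-right-half : ∀ {fs} → ConeNonNeg fs → ConeNonNeg (swap fs) → ∀ a b → 0ℚ ≤ a → 0ℚ ≤ ⟦ fs ⟧ a b
nonNeg-right-half {fs} cone cone′ a b 0≤a with b ℚP.≤? a | - a ℚP.≤? b
... | yes b≤a | yes -a≤b = cone a b -a≤b b≤a
... | yes b≤a | no  -a≰b = subst (0ℚ ≤_) (trans (⟦swap⟧ fs (- b) (- a)) (⟦⟧-neg fs a b))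
  (cone′ (- b) (- a) (subst (_≤ - a) (sym (neg-involutive b)) (ℚP.<⇒≤ (ℚP.≰⇒> -a≰b))) (ℚP.neg-antimono-≤ b≤a))
... | no  b≰a | _        = subst (0ℚ ≤_) (⟦swap⟧ fs b a)
  (cone′ b a (ℚP.≤-trans (ℚP.neg-antimono-≤ (ℚP.≤-trans 0≤a a≤b)) 0≤a) a≤b)
  where a≤b = ℚP.<⇒≤ (ℚP.≰⇒> b≰a)

nonNeg-from-cones : ∀ {fs} → ConeNonNeg fs → ConeNonNeg (swap fs) → ∀ a b → 0ℚ ≤ ⟦ fs ⟧ a b
nonNeg-from-cones {fs} cone cone′ a b with 0ℚ ℚP.≤? a
... | yes 0≤a = nonNeg-right-half {fs} cone cone′ a b 0≤a
... | no  0≰a = subst (0ℚ ≤_) (⟦⟧-neg fs a b)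
  (nonNeg-right-half {fs} cone cone′ (- a) (- b) (ℚP.neg-antimono-≤ (ℚP.<⇒≤ (ℚP.≰⇒> 0≰a))))

sameSign? : ∀ u v → Dec (SameSign u v)
sameSign? u v = (0ℚ ℚP.≤? u ×-dec 0ℚ ℚP.≤? v) ⊎-dec (u ℚP.≤? 0ℚ ×-dec v ℚP.≤? 0ℚ)

affineOn? : ∀ fs x y → Dec (AffineOn fs x y)
affineOn? fs x y = x ℚP.<? y ×-dec All.all? (λ (_ , p , q) → sameSign? (p * 1ℚ + q * x) (p * 1ℚ + q * y)) fs

certificate? : ∀ fs ss → Dec (Certificate fs ss)
certificate? fs ss = All.all? (λ s → 0ℚ ℚP.≤? ⟦ fs ⟧ 1ℚ s) ss ×-dec Linked.linked? (affineOn? fs) ss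

-- ys are the inner breakpoints of the slope b / a ∈ [-1, 1]; the swapped forms cover the slopes a / b ∈ [-1, 1].
PlaneCertificate : List Form → List ℚ → Set
PlaneCertificate fs ys = Certificate fs (- 1ℚ ∷ ys ++ [ 1ℚ ]) × Certificate (swap fs) (- 1ℚ ∷ ys ++ [ 1ℚ ])

planeCertificate? : ∀ fs ys → Dec (PlaneCertificate fs ys)
planeCertificate? fs ys = certificate? fs _ ×-dec certificate? (swap fs) _

certified-nonNeg : ∀ {fs} ys → PlaneCertificate fs ys → ∀ a b → 0ℚ ≤ ⟦ fs ⟧ a b
certified-nonNeg {fs} ys (cert , cert′) =
  nonNeg-from-cones {fs} (certified-cone {fs} ys cert) (certified-cone {swap fs} ys cert′)

certified-≤ : ∀ gs fs ys {_ : True (planeCertificate? (gs ⊖ fs) ys)} → ∀ a b → ⟦ fs ⟧ a b ≤ ⟦ gs ⟧ a b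
certified-≤ gs fs ys {cert} a b =
  0≤q-p⇒p≤q (subst (0ℚ ≤_) (⟦⊖⟧ gs fs a b) (certified-nonNeg {gs ⊖ fs} ys (toWitness cert) a b))

-- The weight ψ and the constants

form : ℤ → ℤ → ℤ → Form
form c p q = fromℤ c , fromℤ p , fromℤ q

-- (p , q) runs over 20 (cos kπ/20 , sin kπ/20), rounded.
forms : List Form
forms =
  form (+ 511) (+ 20) (+ 0) ∷ form (+ 192) (+ 20) (+ 3) ∷ form (+ 328) (+ 19) (+ 6) ∷ form (+ 178) (+ 18) (+ 9) ∷
  form (+ 187) (+ 16) (+ 12) ∷ form (+ 488) (+ 14) (+ 14) ∷ form (+ 187) (+ 12) (+ 16) ∷ form (+ 178) (+ 9) (+ 18) ∷
  form (+ 328) (+ 6) (+ 19) ∷ form (+ 192) (+ 3) (+ 20) ∷ form (+ 511) (+ 0) (+ 20) ∷ form (+ 192) (ℤ.- + 3) (+ 20) ∷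
  form (+ 114) (ℤ.- + 6) (+ 19) ∷ form (+ 101) (ℤ.- + 9) (+ 18) ∷ form (+ 30) (ℤ.- + 12) (+ 16) ∷ form (+ 314) (ℤ.- + 14) (+ 14) ∷
  form (+ 30) (ℤ.- + 16) (+ 12) ∷ form (+ 101) (ℤ.- + 18) (+ 9) ∷ form (+ 114) (ℤ.- + 19) (+ 6) ∷ form (+ 192) (ℤ.- + 20) (+ 3) ∷ []

slopes : List ℚ
slopes =
  - (+ 10 / 13) ∷ - (+ 3 / 4) ∷ - (+ 7 / 10) ∷ - (+ 19 / 31) ∷ - (+ 1 / 2) ∷ - (+ 2 / 5) ∷ - (+ 7 / 19) ∷ - (+ 1 / 3) ∷
  - (+ 6 / 19) ∷ - (+ 3 / 11) ∷ - (+ 1 / 5) ∷ - (+ 3 / 20) ∷ - (+ 3 / 22) ∷ - (+ 3 / 43) ∷ 0ℚ ∷ + 3 / 37 ∷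
  + 3 / 20 ∷ + 3 / 16 ∷ + 6 / 19 ∷ + 1 / 3 ∷ + 1 / 2 ∷ + 3 / 5 ∷ + 3 / 4 ∷ []

μ₀ ν₀ κ₀ : ℚ
μ₀ = + 773 / 500
ν₀ = + 39 / 25
κ₀ = + 10220 / 1

ψ : ℚ → ℚ → ℚ
ψ = ⟦ forms ⟧

ψ-split-≥ : ∀ a b → μ₀ * ψ a b ≤ ψ a (negMean a b) + ψ (negMean a b) b
ψ-split-≥ a b = subst₂ _≤_ (⟦scale⟧ μ₀ forms a b) (⟦split⟧ forms a b)
  (certified-≤ (split forms) (scale μ₀ forms) slopes a b)

ψ-split-≤ : ∀ a b → ψ a (negMean a b) + ψ (negMean a b) b ≤ ν₀ * ψ a b
ψ-split-≤ a b = subst₂ _≤_ (⟦split⟧ forms a b) (⟦scale⟧ ν₀ forms a b)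
  (certified-≤ (scale ν₀ forms) (split forms) slopes a b)

weights-nonNeg : NonNegWeights forms
weights-nonNeg = toWitness {a? = nonNegWeights? forms} _

ψ-≥ : ∀ a b → κ₀ * ∣ a ∣ ≤ ψ a b
ψ-≥ a b = begin
  κ₀ * ∣ a ∣                                 ≡⟨ ℚP.*-assoc 511ℚ 20ℚ ∣ a ∣ ⟩
  511ℚ * (20ℚ * ∣ a ∣)                       ≡⟨ cong (511ℚ *_) (ℚP.∣p*q∣≡∣p∣*∣q∣ 20ℚ a) ⟨
  511ℚ * ∣ 20ℚ * a ∣                         ≡⟨ cong (λ x → 511ℚ * ∣ x ∣) (k*a+0*b≡k*a 20ℚ a b) ⟨
  511ℚ * ∣ 20ℚ * a + 0ℚ * b ∣                ≤⟨ ⟦⟧-≥-head {511ℚ} {20ℚ} {0ℚ} (All.tail weights-nonNeg) a b ⟩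
  ψ a b                                      ∎
  where
  open ℚP.≤-Reasoning
  511ℚ = fromℤ (+ 511)
  20ℚ = fromℤ (+ 20)
  k*a+0*b≡k*a : ∀ k a b → k * a + 0ℚ * b ≡ k * a
  k*a+0*b≡k*a = solve-∀ ℚ-ring

C₀ : ℚ
C₀ = ℓ¹-weight forms

ψ-≤ : ∀ a b → ψ a b ≤ C₀ * (∣ a ∣ + ∣ b ∣)
ψ-≤ = ⟦⟧-≤-ℓ¹ weights-nonNeg

negMean-fixed-point : ∀ x → x ≡ negMean 1ℚ x → x ≡ - (+ 1 / 3)
negMean-fixed-point x x≡-½[1+x] = begin
  x                                ≡⟨ ℚP.*-identityʳ x ⟨
  x * ((1ℚ + ½) * (+ 2 / 3))       ≡⟨ ℚP.*-assoc x (1ℚ + ½) (+ 2 / 3) ⟨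
  x * (1ℚ + ½) * (+ 2 / 3)         ≡⟨ cong (_* (+ 2 / 3)) (ring ½ x) ⟩
  (x - negMean 1ℚ x + - ½) * (+ 2 / 3)  ≡⟨ cong (λ y → (x - y + - ½) * (+ 2 / 3)) x≡-½[1+x] ⟨
  (x - x + - ½) * (+ 2 / 3)        ≡⟨ cong (λ y → (y + - ½) * (+ 2 / 3)) (ℚP.+-inverseʳ x) ⟩
  - (+ 1 / 3)                      ∎
  where
  open ≡-Reasoning
  ring : ∀ h x → x * (1ℚ + h) ≡ x - - (h * (1ℚ + x)) + - h
  ring = solve-∀ ℚ-ring

2^a≤μ₀^d : pow two 6274882485 ≤ pow μ₀ 10000000000
2^a≤μ₀^d = x^[p/q+1]≤y⇒x^[a/d]≤y {two} {μ₀} 6274882485 10000000000 27 42 compute-≤ compute-≤ compute-≤ (ℕP.≤ᵇ⇒≤ _ _ _)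

ν₀^d≤2^b : pow ν₀ 10000000000 ≤ pow two 6464616661
ν₀^d≤2^b = y≤x^[p/q+1]⇒y^[d/b]≤x {two} {ν₀} 6464616661 10000000000 9 13 compute-≤ compute-≤ compute-≤ (ℕP.≤ᵇ⇒≤ _ _ _)

c₁ c₂ D₀ : ℚ
c₁ = + 1 / 20
D₀ = + 6 / 1
c₂ = D₀ * ν₀

module Bounds (η : ℕ → ℚ) (η-0 : η 0 ≡ 1ℚ)
  (η-double   : ∀ m → η (m ℕ.* 2) ≡ η m)
  (η-double+1 : ∀ m → η (suc (m ℕ.* 2)) ≡ negMean (η m) (η (suc m)))
  where

  open BlockGrowth η η-double η-double+1 ψ {μ₀} {ν₀} {κ₀} {C₀}
    compute-≤ compute-≤ compute-< compute-≤ ψ-split-≥ ψ-split-≤ ψ-≥ ψ-≤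

  η-1 : η 1 ≡ - (+ 1 / 3)
  η-1 = negMean-fixed-point (η 1) (trans (η-double+1 0) (cong (λ y → negMean y (η 1)) η-0))

  block-Ψ-0 : block Ψ 0 ≡ ψ (- (+ 1 / 3)) (- (+ 1 / 3)) + 0ℚ
  block-Ψ-0 = cong₂ (λ a b → ψ a b + 0ℚ) η-1 (trans (η-double 1) η-1)

  sumAbs-≥ : ∀ n N → 2 ^ n ℕ.≤ N → c₁ * pow μ₀ (suc n) ≤ sumAbs η N
  sumAbs-≥ zero N _ = begin
    c₁ * pow μ₀ 1                   ≤⟨ compute-≤ ⟩
    1ℚ                              ≡⟨ trans (ℚP.+-identityʳ ∣ η 0 ∣) (cong ∣_∣ η-0) ⟨
    sumRange (∣_∣ ∘ η) 0 1          ≤⟨ sumRange-mono-len (ℚP.0≤∣p∣ ∘ η) 0 (s≤s (z≤n {N})) ⟩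
    sumRange (∣_∣ ∘ η) 0 (suc N)    ≡⟨ sumAbs≡sumRange η N ⟨
    sumAbs η N                      ∎
    where open ℚP.≤-Reasoning
  sumAbs-≥ (suc k) N 2ᵏ⁺¹≤N = ℚP.*-cancelˡ-≤-pos (C₀ + C₀) {{ℚ.positive {C₀ + C₀} compute-<}} (begin
    (C₀ + C₀) * (c₁ * pow μ₀ (suc (suc k)))       ≡⟨ ring (C₀ + C₀) c₁ μ₀ (pow μ₀ k) ⟩
    ((C₀ + C₀) * c₁ * μ₀ * μ₀) * pow μ₀ k         ≤⟨ ℚP.*-monoʳ-≤-nonNeg (pow μ₀ k)
                                                       {{ℚ.nonNegative (pow-nonNeg k compute-≤)}} ψ₀-large ⟩
    (ψ (- (+ 1 / 3)) (- (+ 1 / 3)) + 0ℚ) * pow μ₀ k ≡⟨ cong (_* pow μ₀ k) block-Ψ-0 ⟨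
    block Ψ 0 * pow μ₀ k                          ≡⟨ ℚP.*-comm (block Ψ 0) (pow μ₀ k) ⟩
    pow μ₀ k * block Ψ 0                          ≤⟨ sumAbs-≥-μⁿ k N 2ᵏ⁺¹≤N ⟩
    (C₀ + C₀) * sumAbs η N                        ∎)
    where
    open ℚP.≤-Reasoning
    ring : ∀ C c μ P → C * (c * (μ * (μ * P))) ≡ (C * c * μ * μ) * P
    ring = solve-∀ ℚ-ring
    ψ₀-large : (C₀ + C₀) * c₁ * μ₀ * μ₀ ≤ ψ (- (+ 1 / 3)) (- (+ 1 / 3)) + 0ℚ
    ψ₀-large = compute-≤

  sumAbs-≤ : ∀ n N → N ℕ.< 2 ^ suc n → sumAbs η N ≤ c₂ * pow ν₀ n
  sumAbs-≤ n N N<2ⁿ⁺¹ = begin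
    sumAbs η N                          ≤⟨ sumAbs-≤-prefix η (suc n) N N<2ⁿ⁺¹ ⟩
    sumRange (∣_∣ ∘ η) 0 (2 ^ suc n)    ≤⟨ prefix-≤ P₀≤D₀ growth (suc n) ⟩
    D₀ * (ν₀ * pow ν₀ n)                ≡⟨ ℚP.*-assoc D₀ ν₀ (pow ν₀ n) ⟨
    c₂ * pow ν₀ n                       ∎
    where
    open ℚP.≤-Reasoning
    P₀≤D₀ : sumRange (∣_∣ ∘ η) 0 1 ≤ D₀
    P₀≤D₀ = subst (_≤ D₀) (cong (λ y → ∣ y ∣ + 0ℚ) (sym η-0)) compute-≤
    growth : κ₀ * D₀ + block Ψ 0 ≤ κ₀ * D₀ * ν₀
    growth = subst (λ y → κ₀ * D₀ + y ≤ κ₀ * D₀ * ν₀) (sym block-Ψ-0) compute-≤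

theorem1p1 : (η : ℕ → ℚ) → (∀ (m : ℕ) → Converges (corrAvg m) (η m)) →
  ∃₂ λ (c₁ c₂ : ℚ) → Positive c₁ × Positive c₂ ×
    (∀ (x : ℚ) → 1ℚ ≤ x →
      LowerBy c₁ x 6274882485 10000000000 (sumAbs η (floorℕ x))
      × UpperBy c₂ x 6464616661 10000000000 (sumAbs η (floorℕ x)))
theorem1p1 η corrAvg→η = c₁ , c₂ , ℚ.positive {c₁} compute-< , ℚ.positive {c₂} compute-< , bounds
  where
  open Autocorrelation η corrAvg→η
  open Bounds η η-0 η-double η-double+1
  -- The implicit arguments are explicit: inferring them would unfold pow _ 6274882485.
  bounds : ∀ x → 1ℚ ≤ x → LowerBy c₁ x 6274882485 10000000000 (sumAbs η (floorℕ x))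
                         × UpperBy c₂ x 6464616661 10000000000 (sumAbs η (floorℕ x))
  bounds x 1≤x =
    let (n , 2ⁿ≤⌊x⌋ , ⌊x⌋<2ⁿ⁺¹ , 2ⁿ≤x , x≤2ⁿ⁺¹) = dyadic-bracket 1≤x
        S = sumAbs η (floorℕ x)
    in lowerBy-dyadic {c₁} {μ₀} {two} {x} {S} 6274882485 10000000000 (suc n)
         compute-≤ compute-≤ compute-≤ (ℚP.≤-trans compute-≤ 1≤x) 2^a≤μ₀^d x≤2ⁿ⁺¹ (sumAbs-≥ n _ 2ⁿ≤⌊x⌋)
     , upperBy-dyadic {c₂} {ν₀} {two} {x} {S} 6464616661 10000000000 n
         (sumAbs-nonNeg η (floorℕ x)) compute-≤ compute-≤ compute-≤ ν₀^d≤2^b 2ⁿ≤x (sumAbs-≤ n _ ⌊x⌋<2ⁿ⁺¹)
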